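{- Let $\mathcal{V}$ be a $\ast$-autonomous category whose monoidal unit $I$ is the dualizing object, and let $A$ be a pseudo-affine object of $\mathcal{V}$. If the semigroup $([A,A],\circ)$ can be completed to a Frobenius structure, i.e. there exist $B,\epsilon,l,r$ such that $([A,A],B,\epsilon,\circ,l,r)$ is a Frobenius structure, then $A$ is part of an adjunction.
   Context: $\mathcal{V}$ is symmetric monoidal closed (strict), with unit $I$, unitors $\lambda,\rho$, symmetry $\sigma$, internal hom $[X,Z]$ right adjoint to $X\otimes -$, evaluation $ev_{X,Z}:X\otimes[X,Z]\to Z$; $X^*:=[X,I]$, and $\ast$-autonomous means the canonical $j_X:X\to X^{**}$ (transpose of $ev_{X,I}\circ\sigma_{X^*,X}$) is always an isomorphism. Internal composition $\circ:[A,A]\otimes[A,A]\to[A,A]$ is the transpose of $ev_{A,A}\circ(ev_{A,A}\otimes[A,A])$. $A$ is pseudo-affine if there are $p: I\to A$, $c: A\to I$ with $c\circ p=\mathrm{id}_I$. An adjunction is a tuple $(A,B,\eta,\epsilon)$ with $\epsilon:A\otimes B\to I$, $\eta: I\to B\otimes A$, such that $\lambda_A\circ(\epsilon\otimes A)\circ(A\otimes\eta)\circ\rho_A^{ -1}=\mathrm{id}_A$ and $\rho_B\circ(B\otimes\epsilon)\circ(\eta\otimes B)\circ\lambda_B^{ -1}=\mathrm{id}_B$; $A$ is part of an adjunction if such $B,\eta,\epsilon$ exist. A dual pairing is $\epsilon: A\otimes B\to I$ such that for all $X$, $f\mapsto\epsilon\circ(A\otimes f)$ is a bijection $\hom(X,B)\to\hom(A\otimes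 X,I)$ and $g\mapsto\epsilon\circ(g\otimes B)$ is a bijection $\hom(X,A)\to\hom(X\otimes B,I)$. For a dual pairing and associative $\mu_A$, $\lhd:A\otimes B\to B$ is the unique map with $\epsilon\circ(A\otimes\lhd)=\epsilon\circ(\mu_A\otimes B)$ and $\rhd:B\otimes A\to B$ the unique map with $\epsilon\circ(A\otimes\rhd)=\epsilon\circ(\mu_A\otimes B)\circ\sigma_{A\otimes B,A}$. A Frobenius structure is $(A,B,\epsilon,\mu_A,l,r)$ with $\epsilon$ a dual pairing, $\mu_A$ associative, $l,r:A\to B$ isomorphisms with $\epsilon\circ(A\otimes r)=\epsilon\circ(A\otimes l)\circ\sigma_{A,A}$ and $\lhd\circ(A\otimes r)=\rhd\circ(l\otimes A)$. -}

module Defs where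

open import Level using (Level; suc; _⊔_)
open import Data.Product using (Σ; Σ-syntax; ∃-syntax; _×_; _,_; proj₁)
open import Relation.Binary.Structures using (IsEquivalence)

record SymMonClosed (o h e : Level) : Set (suc (o ⊔ h ⊔ e)) where
  infixr 9 _∘_
  infix  4 _≈_
  infixr 10 _⊗₀_ _⊗₁_
  field
    Obj  : Set o
    Hom  : Obj → Obj → Set h
    _≈_  : ∀ {X Y} → Hom X Y → Hom X Y → Set e
    ≈-equiv : ∀ {X Y} → IsEquivalence (_≈_ {X} {Y})
    id   : ∀ {X} → Hom X X
    _∘_  : ∀ {X Y Z} → Hom Y Z → Hom X Y → Hom X Z
    ∘-assoc : ∀ {W X Y Z} {f : Hom Y Z} {g : Hom X Y} {k : Hom W X} →
              (f ∘ g) ∘ k ≈ f ∘ (g ∘ k)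
    identityˡ : ∀ {X Y} {f : Hom X Y} → id ∘ f ≈ f
    identityʳ : ∀ {X Y} {f : Hom X Y} → f ∘ id ≈ f
    ∘-resp-≈ : ∀ {X Y Z} {f f′ : Hom Y Z} {g g′ : Hom X Y} →
               f ≈ f′ → g ≈ g′ → f ∘ g ≈ f′ ∘ g′

    _⊗₀_ : Obj → Obj → Obj
    _⊗₁_ : ∀ {X Y Z W} → Hom X Y → Hom Z W → Hom (X ⊗₀ Z) (Y ⊗₀ W)
    ⊗-id : ∀ {X Y} → id {X} ⊗₁ id {Y} ≈ id
    ⊗-∘  : ∀ {X Y Z X′ Y′ Z′} {f : Hom Y Z} {g : Hom X Y}
             {f′ : Hom Y′ Z′} {g′ : Hom X′ Y′} →
           (f ∘ g) ⊗₁ (f′ ∘ g′) ≈ (f ⊗₁ f′) ∘ (g ⊗₁ g′)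
    ⊗-resp-≈ : ∀ {X Y Z W} {f f′ : Hom X Y} {g g′ : Hom Z W} →
               f ≈ f′ → g ≈ g′ → f ⊗₁ g ≈ f′ ⊗₁ g′

    I : Obj
    unitorˡ⇒ : ∀ {X} → Hom (I ⊗₀ X) X
    unitorˡ⇐ : ∀ {X} → Hom X (I ⊗₀ X)
    unitorˡ-isoˡ : ∀ {X} → unitorˡ⇐ {X} ∘ unitorˡ⇒ ≈ id
    unitorˡ-isoʳ : ∀ {X} → unitorˡ⇒ {X} ∘ unitorˡ⇐ ≈ id
    unitorˡ-natural : ∀ {X Y} {f : Hom X Y} → unitorˡ⇒ ∘ (id ⊗₁ f) ≈ f ∘ unitorˡ⇒
    ρ⇒ : ∀ {X} → Hom (X ⊗₀ I) X
    ρ⇐ : ∀ {X} → Hom X (X ⊗₀ I)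
    ρ-isoˡ : ∀ {X} → ρ⇐ {X} ∘ ρ⇒ ≈ id
    ρ-isoʳ : ∀ {X} → ρ⇒ {X} ∘ ρ⇐ ≈ id
    ρ-natural : ∀ {X Y} {f : Hom X Y} → ρ⇒ ∘ (f ⊗₁ id) ≈ f ∘ ρ⇒

    α⇒ : ∀ {X Y Z} → Hom ((X ⊗₀ Y) ⊗₀ Z) (X ⊗₀ (Y ⊗₀ Z))
    α⇐ : ∀ {X Y Z} → Hom (X ⊗₀ (Y ⊗₀ Z)) ((X ⊗₀ Y) ⊗₀ Z)
    α-isoˡ : ∀ {X Y Z} → α⇐ {X} {Y} {Z} ∘ α⇒ ≈ id
    α-isoʳ : ∀ {X Y Z} → α⇒ {X} {Y} {Z} ∘ α⇐ ≈ id
    α-natural : ∀ {X Y Z X′ Y′ Z′} {f : Hom X X′} {g : Hom Y Y′} {k : Hom Z Z′} →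
                α⇒ ∘ ((f ⊗₁ g) ⊗₁ k) ≈ (f ⊗₁ (g ⊗₁ k)) ∘ α⇒

    triangle : ∀ {X Y} → (id {X} ⊗₁ unitorˡ⇒ {Y}) ∘ α⇒ ≈ ρ⇒ ⊗₁ id
    pentagon : ∀ {W X Y Z} →
               (id {W} ⊗₁ α⇒ {X} {Y} {Z}) ∘ (α⇒ ∘ (α⇒ ⊗₁ id)) ≈ α⇒ ∘ α⇒

    σ : ∀ {X Y} → Hom (X ⊗₀ Y) (Y ⊗₀ X)
    σ-natural : ∀ {X Y X′ Y′} {f : Hom X X′} {g : Hom Y Y′} →
                σ ∘ (f ⊗₁ g) ≈ (g ⊗₁ f) ∘ σ
    σ-involutive : ∀ {X Y} → σ {Y} {X} ∘ σ {X} {Y} ≈ id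
    hexagon : ∀ {X Y Z} →
              α⇒ {Y} {Z} {X} ∘ (σ {X} {Y ⊗₀ Z} ∘ α⇒ {X} {Y} {Z})
                ≈ (id ⊗₁ σ) ∘ (α⇒ ∘ (σ ⊗₁ id))

    [_,_] : Obj → Obj → Obj
    ev    : ∀ {X Z} → Hom (X ⊗₀ [ X , Z ]) Z
    curry : ∀ {X Y Z} → Hom (X ⊗₀ Y) Z → Hom Y [ X , Z ]
    ev-curry : ∀ {X Y Z} {f : Hom (X ⊗₀ Y) Z} → ev ∘ (id ⊗₁ curry f) ≈ f
    curry-unique : ∀ {X Y Z} {f : Hom (X ⊗₀ Y) Z} {g : Hom Y [ X , Z ]} →
                   ev ∘ (id ⊗₁ g) ≈ f → g ≈ curry f

module Notions {o h e : Level} (V : SymMonClosed o h e) where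
  open SymMonClosed V

  IsIso : ∀ {X Y} → Hom X Y → Set (h ⊔ e)
  IsIso {X} {Y} f = Σ[ g ∈ Hom Y X ] ((g ∘ f ≈ id) × (f ∘ g ≈ id))

  _* : Obj → Obj
  X * = [ X , I ]

  j : ∀ X → Hom X ((X *) *)
  j X = curry (ev {X} {I} ∘ σ {X *} {X})

  IsStarAutonomous : Set (o ⊔ h ⊔ e)
  IsStarAutonomous = ∀ X → IsIso (j X)

  IsPseudoAffine : Obj → Set (h ⊔ e)
  IsPseudoAffine A = Σ[ p ∈ Hom I A ] Σ[ c ∈ Hom A I ] (c ∘ p ≈ id)

  intComp : ∀ A → Hom ([ A , A ] ⊗₀ [ A , A ]) [ A , A ]
  intComp A = curry (ev {A} {A} ∘ ((ev {A} {A} ⊗₁ id) ∘ α⇐))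

  IsAdjunction : ∀ A B → Hom I (B ⊗₀ A) → Hom (A ⊗₀ B) I → Set e
  IsAdjunction A B η ε =
    (unitorˡ⇒ ∘ ((ε ⊗₁ id {A}) ∘ (α⇐ ∘ ((id {A} ⊗₁ η) ∘ ρ⇐))) ≈ id {A}) ×
    (ρ⇒ ∘ ((id {B} ⊗₁ ε) ∘ (α⇒ ∘ ((η ⊗₁ id {B}) ∘ unitorˡ⇐))) ≈ id {B})

  PartOfAdjunction : Obj → Set (o ⊔ h ⊔ e)
  PartOfAdjunction A =
    Σ[ B ∈ Obj ] Σ[ η ∈ Hom I (B ⊗₀ A) ] Σ[ ε ∈ Hom (A ⊗₀ B) I ] IsAdjunction A B η ε

  -- bijection of hom-setoids (the maps below respect ≈ automatically)
  Injective : ∀ {X Y Z W} → (Hom X Y → Hom Z W) → Set (h ⊔ e)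
  Injective F = ∀ {f g} → F f ≈ F g → f ≈ g

  Surjective : ∀ {X Y Z W} → (Hom X Y → Hom Z W) → Set (h ⊔ e)
  Surjective {X} {Y} F = ∀ k → Σ[ f ∈ Hom X Y ] (F f ≈ k)

  record IsDualPairing {A B : Obj} (ε : Hom (A ⊗₀ B) I) : Set (o ⊔ h ⊔ e) where
    field
      injʳ  : ∀ X → Injective (λ (f : Hom X B) → ε ∘ (id {A} ⊗₁ f))
      surjʳ : ∀ X → Surjective (λ (f : Hom X B) → ε ∘ (id {A} ⊗₁ f))
      injˡ  : ∀ X → Injective (λ (g : Hom X A) → ε ∘ (g ⊗₁ id {B}))
      surjˡ : ∀ X → Surjective (λ (g : Hom X A) → ε ∘ (g ⊗₁ id {B}))

  module _ {A B : Obj} {ε : Hom (A ⊗₀ B) I} (dp : IsDualPairing ε)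
           (μ : Hom (A ⊗₀ A) A) where
    open IsDualPairing dp

    -- ◁ : A ⊗ B → B , the unique map with ε∘(A⊗◁) = ε∘(μ⊗B)  (associator inserted)
    ◁ : Hom (A ⊗₀ B) B
    ◁ = proj₁ (surjʳ (A ⊗₀ B) (ε ∘ ((μ ⊗₁ id {B}) ∘ α⇐)))

    -- ▷ : B ⊗ A → B , the unique map with ε∘(A⊗▷) = ε∘(μ⊗B)∘σ_{A⊗B,A}
    ▷ : Hom (B ⊗₀ A) B
    ▷ = proj₁ (surjʳ (B ⊗₀ A)
          (ε ∘ ((μ ⊗₁ id {B}) ∘ (α⇐ ∘ (σ {A ⊗₀ B} {A} ∘ α⇐)))))

  IsAssociative : ∀ {A} → Hom (A ⊗₀ A) A → Set e
  IsAssociative μ = μ ∘ (μ ⊗₁ id) ≈ μ ∘ ((id ⊗₁ μ) ∘ α⇒)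

  record IsFrobeniusStructure (A B : Obj) (ε : Hom (A ⊗₀ B) I)
         (μ : Hom (A ⊗₀ A) A) (l r : Hom A B) : Set (o ⊔ h ⊔ e) where
    field
      dualPairing : IsDualPairing ε
      μ-assoc     : IsAssociative μ
      l-iso       : IsIso l
      r-iso       : IsIso r
      ε-lr        : ε ∘ (id {A} ⊗₁ r) ≈ (ε ∘ (id {A} ⊗₁ l)) ∘ σ {A} {A}
      ◁▷-lr       : ◁ dualPairing μ ∘ (id {A} ⊗₁ r) ≈ ▷ dualPairing μ ∘ (l ⊗₁ id {A})

module Submission where

-- Write E = [ A , A ], D = A * and 1 : I → E for the unit of internal composition μ. The
-- Frobenius axioms turn the pairing ε ∘ (E ⊗ r) into τ ∘ μ ∘ σ for the form τ f = ε (f ⊗ l 1).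
-- As ε is a dual pairing and r is invertible, τ is nondegenerate, so the pseudo-affine c yields
-- g : A → E with τ (g a ∘ f) = c (f a). Star-autonomy makes E a retract of (D ⊗ A)* and turns
-- the functional induced by τ into a point w : I → D ⊗ A with ⟨ snakeˡ w a , d ⟩ = τ (x ↦ d x · a).
-- For s a = g a p this gives snakeˡ w ∘ s = id, i.e. η = (s* ⊗ A) ∘ w and ε = ev satisfy the
-- first triangle identity; the second follows since maps into D are determined by ev.

open import Level using (Level; _⊔_)
open import Data.Product using (Σ-syntax; _,_; proj₁; proj₂)
open import Relation.Binary.Structures using (IsEquivalence)
open import Relation.Binary.Bundles using (Setoid)
import Relation.Binary.Reasoning.Setoid as SetoidR
open import Defs

module Properties {o h e : Level} (V : SymMonClosed o h e) where
  open SymMonClosed V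

  hom-setoid : Obj → Obj → Setoid h e
  hom-setoid X Y = record { Carrier = Hom X Y ; _≈_ = _≈_ ; isEquivalence = ≈-equiv }

  module HomReasoning {X Y : Obj} = SetoidR (hom-setoid X Y)
  open HomReasoning public

  module _ {X Y : Obj} where
    open IsEquivalence (≈-equiv {X} {Y}) public
      renaming (refl to ≈-refl; sym to ≈-sym; trans to ≈-trans)

  infixr 4 _⟩∘⟨_ _⟩⊗⟨_
  _⟩∘⟨_ : ∀ {X Y Z} {f f′ : Hom Y Z} {g g′ : Hom X Y} → f ≈ f′ → g ≈ g′ → f ∘ g ≈ f′ ∘ g′
  _⟩∘⟨_ = ∘-resp-≈
  _⟩⊗⟨_ : ∀ {X Y Z W} {f f′ : Hom X Y} {g g′ : Hom Z W} → f ≈ f′ → g ≈ g′ → f ⊗₁ g ≈ f′ ⊗₁ g′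
  _⟩⊗⟨_ = ⊗-resp-≈

  refl⟩∘⟨_ : ∀ {X Y Z} {f : Hom Y Z} {g g′ : Hom X Y} → g ≈ g′ → f ∘ g ≈ f ∘ g′
  refl⟩∘⟨ p = ≈-refl ⟩∘⟨ p
  _⟩∘⟨refl : ∀ {X Y Z} {f f′ : Hom Y Z} {g : Hom X Y} → f ≈ f′ → f ∘ g ≈ f′ ∘ g
  p ⟩∘⟨refl = p ⟩∘⟨ ≈-refl
  infix 5 refl⟩∘⟨_
  infixl 5 _⟩∘⟨refl

  assoc : ∀ {W X Y Z} {f : Hom Y Z} {g : Hom X Y} {k : Hom W X} → (f ∘ g) ∘ k ≈ f ∘ (g ∘ k)
  assoc = ∘-assoc
  sym-assoc : ∀ {W X Y Z} {f : Hom Y Z} {g : Hom X Y} {k : Hom W X} → f ∘ (g ∘ k) ≈ (f ∘ g) ∘ k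
  sym-assoc = ≈-sym ∘-assoc

  assoc₄ : ∀ {X₀ X₁ X₂ X₃ X₄ X₅ X₆} {a : Hom X₅ X₆} {b : Hom X₄ X₅} {c : Hom X₃ X₄} {d : Hom X₂ X₃}
             {f : Hom X₁ X₂} {g : Hom X₀ X₁} →
           (a ∘ (b ∘ (c ∘ (d ∘ f)))) ∘ g ≈ a ∘ (b ∘ (c ∘ (d ∘ (f ∘ g))))
  assoc₄ = ≈-trans assoc (refl⟩∘⟨ ≈-trans assoc (refl⟩∘⟨ ≈-trans assoc (refl⟩∘⟨ assoc)))

  pullˡ : ∀ {W X Y Z} {a : Hom Y Z} {b : Hom X Y} {c : Hom X Z} {f : Hom W X} → a ∘ b ≈ c → a ∘ (b ∘ f) ≈ c ∘ f
  pullˡ p = ≈-trans sym-assoc (p ⟩∘⟨refl)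
  cancelˡ : ∀ {W X Y} {a : Hom X Y} {b : Hom Y X} {f : Hom W Y} → a ∘ b ≈ id → a ∘ (b ∘ f) ≈ f
  cancelˡ p = ≈-trans (pullˡ p) identityˡ
  cancelʳ : ∀ {X Y Z} {a : Hom Y X} {b : Hom X Y} {f : Hom X Z} → a ∘ b ≈ id → f ∘ (a ∘ b) ≈ f
  cancelʳ p = ≈-trans (refl⟩∘⟨ p) identityʳ
  insertˡ : ∀ {W X Y} {a : Hom X Y} {b : Hom Y X} {f : Hom W Y} → a ∘ b ≈ id → f ≈ a ∘ (b ∘ f)
  insertˡ p = ≈-sym (cancelˡ p)

  split : ∀ {X Y Z X′ Y′ Z′} {f : Hom Y Z} {g : Hom X Y} {f′ : Hom Y′ Z′} {g′ : Hom X′ Y′} →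
          (f ∘ g) ⊗₁ (f′ ∘ g′) ≈ (f ⊗₁ f′) ∘ (g ⊗₁ g′)
  split = ⊗-∘
  merge : ∀ {X Y Z X′ Y′ Z′} {f : Hom Y Z} {g : Hom X Y} {f′ : Hom Y′ Z′} {g′ : Hom X′ Y′} →
          (f ⊗₁ f′) ∘ (g ⊗₁ g′) ≈ (f ∘ g) ⊗₁ (f′ ∘ g′)
  merge = ≈-sym ⊗-∘
  split₂ : ∀ {A X Y Z} {f : Hom Y Z} {g : Hom X Y} → id {A} ⊗₁ (f ∘ g) ≈ (id ⊗₁ f) ∘ (id ⊗₁ g)
  split₂ = ≈-trans (≈-sym identityˡ ⟩⊗⟨ ≈-refl) ⊗-∘
  split₁ : ∀ {A X Y Z} {f : Hom Y Z} {g : Hom X Y} → (f ∘ g) ⊗₁ id {A} ≈ (f ⊗₁ id) ∘ (g ⊗₁ id)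
  split₁ = ≈-trans (≈-refl ⟩⊗⟨ ≈-sym identityˡ) ⊗-∘
  merge₂ : ∀ {A X Y Z} {f : Hom Y Z} {g : Hom X Y} → (id {A} ⊗₁ f) ∘ (id ⊗₁ g) ≈ id ⊗₁ (f ∘ g)
  merge₂ = ≈-sym split₂
  merge₁ : ∀ {A X Y Z} {f : Hom Y Z} {g : Hom X Y} → (f ⊗₁ id {A}) ∘ (g ⊗₁ id) ≈ (f ∘ g) ⊗₁ id
  merge₁ = ≈-sym split₁

  ⊗-as-ˡʳ : ∀ {X Y Z W} {f : Hom X Y} {g : Hom Z W} → f ⊗₁ g ≈ (f ⊗₁ id) ∘ (id ⊗₁ g)
  ⊗-as-ˡʳ = ≈-trans (≈-sym identityʳ ⟩⊗⟨ ≈-sym identityˡ) ⊗-∘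
  ⊗-as-ʳˡ : ∀ {X Y Z W} {f : Hom X Y} {g : Hom Z W} → f ⊗₁ g ≈ (id ⊗₁ g) ∘ (f ⊗₁ id)
  ⊗-as-ʳˡ = ≈-trans (≈-sym identityˡ ⟩⊗⟨ ≈-sym identityʳ) ⊗-∘
  interchange : ∀ {X Y Z W} {f : Hom X Y} {g : Hom Z W} → (f ⊗₁ id) ∘ (id ⊗₁ g) ≈ (id ⊗₁ g) ∘ (f ⊗₁ id)
  interchange = ≈-trans (≈-sym ⊗-as-ˡʳ) ⊗-as-ʳˡ

  swap-iso : ∀ {X Y X′ Y′} {i : Hom X Y} {i′ : Hom Y X} {j₁ : Hom X′ Y′} {j′ : Hom Y′ X′}
              {a : Hom X X′} {b : Hom Y Y′} →
            j′ ∘ j₁ ≈ id → i ∘ i′ ≈ id → j₁ ∘ a ≈ b ∘ i → a ∘ i′ ≈ j′ ∘ b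
  swap-iso {i = i} {i′} {j₁} {j′} {a} {b} jj ii p = begin
    a ∘ i′                 ≈⟨ insertˡ jj ⟩
    j′ ∘ (j₁ ∘ (a ∘ i′))   ≈⟨ refl⟩∘⟨ pullˡ p ⟩
    j′ ∘ ((b ∘ i) ∘ i′)    ≈⟨ refl⟩∘⟨ assoc ⟩
    j′ ∘ (b ∘ (i ∘ i′))    ≈⟨ refl⟩∘⟨ cancelʳ ii ⟩
    j′ ∘ b ∎

  cancel-isoˡ : ∀ {X Y Z} {i : Hom Y Z} {i′ : Hom Z Y} {f g : Hom X Y} → i′ ∘ i ≈ id → i ∘ f ≈ i ∘ g → f ≈ g
  cancel-isoˡ {i = i} {i′} {f} {g} ii p = begin
    f ≈⟨ insertˡ ii ⟩ i′ ∘ (i ∘ f) ≈⟨ refl⟩∘⟨ p ⟩ i′ ∘ (i ∘ g) ≈⟨ cancelˡ ii ⟩ g ∎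

  cancel-isoʳ : ∀ {X Y Z} {i : Hom X Y} {i′ : Hom Y X} {f g : Hom Y Z} → i ∘ i′ ≈ id → f ∘ i ≈ g ∘ i → f ≈ g
  cancel-isoʳ {i = i} {i′} {f} {g} ii p = begin
    f ≈⟨ ≈-sym (cancelʳ ii) ⟩ f ∘ (i ∘ i′) ≈⟨ sym-assoc ⟩ (f ∘ i) ∘ i′ ≈⟨ p ⟩∘⟨refl ⟩
    (g ∘ i) ∘ i′ ≈⟨ assoc ⟩ g ∘ (i ∘ i′) ≈⟨ cancelʳ ii ⟩ g ∎

  iso-comp : ∀ {X Y Z} {a : Hom Y Z} {a′ : Hom Z Y} {b : Hom X Y} {b′ : Hom Y X} →
             a ∘ a′ ≈ id → b ∘ b′ ≈ id → (a ∘ b) ∘ (b′ ∘ a′) ≈ id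
  iso-comp aa bb = ≈-trans assoc (≈-trans (refl⟩∘⟨ pullˡ bb) (≈-trans (refl⟩∘⟨ identityˡ) aa))

  iso⊗id : ∀ {X Y Z} {a : Hom X Y} {a′ : Hom Y X} → a ∘ a′ ≈ id → (a ⊗₁ id {Z}) ∘ (a′ ⊗₁ id) ≈ id
  iso⊗id aa = ≈-trans merge₁ (≈-trans (aa ⟩⊗⟨ ≈-refl) ⊗-id)
  iso⊗idˡ : ∀ {X Y Z} {a : Hom X Y} {a′ : Hom Y X} → a ∘ a′ ≈ id → (id {Z} ⊗₁ a) ∘ (id ⊗₁ a′) ≈ id
  iso⊗idˡ aa = ≈-trans merge₂ (≈-trans (≈-refl ⟩⊗⟨ aa) ⊗-id)

  α⇐-natural : ∀ {X Y Z X′ Y′ Z′} {f : Hom X X′} {g : Hom Y Y′} {k : Hom Z Z′} →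
               α⇐ ∘ (f ⊗₁ (g ⊗₁ k)) ≈ ((f ⊗₁ g) ⊗₁ k) ∘ α⇐
  α⇐-natural = ≈-sym (swap-iso α-isoˡ α-isoʳ α-natural)

  unitorˡ⇐-natural : ∀ {X Y} {f : Hom X Y} → unitorˡ⇐ ∘ f ≈ (id ⊗₁ f) ∘ unitorˡ⇐
  unitorˡ⇐-natural = ≈-sym (swap-iso unitorˡ-isoˡ unitorˡ-isoʳ unitorˡ-natural)

  ρ⇐-natural : ∀ {X Y} {f : Hom X Y} → ρ⇐ ∘ f ≈ (f ⊗₁ id) ∘ ρ⇐
  ρ⇐-natural = ≈-sym (swap-iso ρ-isoˡ ρ-isoʳ ρ-natural)

  unitorˡ-faithful : ∀ {X Y} {f g : Hom X Y} → id {I} ⊗₁ f ≈ id ⊗₁ g → f ≈ g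
  unitorˡ-faithful p = ≈-trans expand (≈-trans (refl⟩∘⟨ (p ⟩∘⟨refl)) (≈-sym expand))
    where
    expand : ∀ {X Y} {f : Hom X Y} → f ≈ unitorˡ⇒ ∘ ((id ⊗₁ f) ∘ unitorˡ⇐)
    expand = ≈-trans (insertˡ unitorˡ-isoʳ) (refl⟩∘⟨ unitorˡ⇐-natural)

  ρ-faithful : ∀ {X Y} {f g : Hom X Y} → f ⊗₁ id {I} ≈ g ⊗₁ id → f ≈ g
  ρ-faithful p = ≈-trans expand (≈-trans (refl⟩∘⟨ (p ⟩∘⟨refl)) (≈-sym expand))
    where
    expand : ∀ {X Y} {f : Hom X Y} → f ≈ ρ⇒ ∘ ((f ⊗₁ id) ∘ ρ⇐)
    expand = ≈-trans (insertˡ ρ-isoʳ) (refl⟩∘⟨ ρ⇐-natural)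

  unitorˡ-α⇒ : ∀ {X Y} → unitorˡ⇒ {X ⊗₀ Y} ∘ α⇒ {I} {X} {Y} ≈ unitorˡ⇒ ⊗₁ id
  unitorˡ-α⇒ {X} {Y} = unitorˡ-faithful (cancel-isoʳ (iso-comp α-isoʳ (iso⊗id α-isoʳ)) chain)
    where
    chain : (id {I} ⊗₁ (unitorˡ⇒ {X ⊗₀ Y} ∘ α⇒ {I} {X} {Y})) ∘ (α⇒ ∘ (α⇒ ⊗₁ id))
          ≈ (id ⊗₁ (unitorˡ⇒ ⊗₁ id)) ∘ (α⇒ ∘ (α⇒ ⊗₁ id))
    chain = begin
      (id ⊗₁ (unitorˡ⇒ ∘ α⇒)) ∘ (α⇒ ∘ (α⇒ ⊗₁ id))       ≈⟨ split₂ ⟩∘⟨refl ⟩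
      ((id ⊗₁ unitorˡ⇒) ∘ (id ⊗₁ α⇒)) ∘ (α⇒ ∘ (α⇒ ⊗₁ id)) ≈⟨ assoc ⟩
      (id ⊗₁ unitorˡ⇒) ∘ ((id ⊗₁ α⇒) ∘ (α⇒ ∘ (α⇒ ⊗₁ id))) ≈⟨ refl⟩∘⟨ pentagon ⟩
      (id ⊗₁ unitorˡ⇒) ∘ (α⇒ ∘ α⇒)                          ≈⟨ sym-assoc ⟩
      ((id ⊗₁ unitorˡ⇒) ∘ α⇒) ∘ α⇒                          ≈⟨ triangle ⟩∘⟨refl ⟩
      (ρ⇒ ⊗₁ id) ∘ α⇒                                        ≈⟨ (≈-refl ⟩⊗⟨ ≈-sym ⊗-id) ⟩∘⟨refl ⟩
      (ρ⇒ ⊗₁ (id ⊗₁ id)) ∘ α⇒                                ≈⟨ ≈-sym α-natural ⟩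
      α⇒ ∘ ((ρ⇒ ⊗₁ id) ⊗₁ id)                                ≈⟨ refl⟩∘⟨ (≈-sym triangle ⟩⊗⟨ ≈-refl) ⟩
      α⇒ ∘ (((id ⊗₁ unitorˡ⇒) ∘ α⇒) ⊗₁ id)                  ≈⟨ refl⟩∘⟨ split₁ ⟩
      α⇒ ∘ (((id ⊗₁ unitorˡ⇒) ⊗₁ id) ∘ (α⇒ ⊗₁ id))          ≈⟨ sym-assoc ⟩
      (α⇒ ∘ ((id ⊗₁ unitorˡ⇒) ⊗₁ id)) ∘ (α⇒ ⊗₁ id)          ≈⟨ α-natural ⟩∘⟨refl ⟩
      ((id ⊗₁ (unitorˡ⇒ ⊗₁ id)) ∘ α⇒) ∘ (α⇒ ⊗₁ id)          ≈⟨ assoc ⟩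
      (id ⊗₁ (unitorˡ⇒ ⊗₁ id)) ∘ (α⇒ ∘ (α⇒ ⊗₁ id)) ∎

  ρ⇒-α⇒ : ∀ {X Y} → ρ⇒ {X ⊗₀ Y} ≈ (id ⊗₁ ρ⇒) ∘ α⇒ {X} {Y} {I}
  ρ⇒-α⇒ {X} {Y} = ρ-faithful (cancel-isoˡ α-isoˡ chain)
    where
    chain : α⇒ ∘ (ρ⇒ {X ⊗₀ Y} ⊗₁ id {I}) ≈ α⇒ ∘ (((id ⊗₁ ρ⇒) ∘ α⇒) ⊗₁ id)
    chain = begin
      α⇒ ∘ (ρ⇒ ⊗₁ id)                                   ≈⟨ refl⟩∘⟨ ≈-sym triangle ⟩
      α⇒ ∘ ((id ⊗₁ unitorˡ⇒) ∘ α⇒)                      ≈⟨ refl⟩∘⟨ ((≈-sym ⊗-id ⟩⊗⟨ ≈-refl) ⟩∘⟨refl) ⟩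
      α⇒ ∘ (((id ⊗₁ id) ⊗₁ unitorˡ⇒) ∘ α⇒)              ≈⟨ sym-assoc ⟩
      (α⇒ ∘ ((id ⊗₁ id) ⊗₁ unitorˡ⇒)) ∘ α⇒              ≈⟨ α-natural ⟩∘⟨refl ⟩
      ((id ⊗₁ (id ⊗₁ unitorˡ⇒)) ∘ α⇒) ∘ α⇒              ≈⟨ assoc ⟩
      (id ⊗₁ (id ⊗₁ unitorˡ⇒)) ∘ (α⇒ ∘ α⇒)              ≈⟨ refl⟩∘⟨ ≈-sym pentagon ⟩
      (id ⊗₁ (id ⊗₁ unitorˡ⇒)) ∘ ((id ⊗₁ α⇒) ∘ (α⇒ ∘ (α⇒ ⊗₁ id))) ≈⟨ sym-assoc ⟩
      ((id ⊗₁ (id ⊗₁ unitorˡ⇒)) ∘ (id ⊗₁ α⇒)) ∘ (α⇒ ∘ (α⇒ ⊗₁ id)) ≈⟨ merge₂ ⟩∘⟨refl ⟩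
      (id ⊗₁ ((id ⊗₁ unitorˡ⇒) ∘ α⇒)) ∘ (α⇒ ∘ (α⇒ ⊗₁ id)) ≈⟨ (≈-refl ⟩⊗⟨ triangle) ⟩∘⟨refl ⟩
      (id ⊗₁ (ρ⇒ ⊗₁ id)) ∘ (α⇒ ∘ (α⇒ ⊗₁ id))            ≈⟨ sym-assoc ⟩
      ((id ⊗₁ (ρ⇒ ⊗₁ id)) ∘ α⇒) ∘ (α⇒ ⊗₁ id)            ≈⟨ ≈-sym α-natural ⟩∘⟨refl ⟩
      (α⇒ ∘ ((id ⊗₁ ρ⇒) ⊗₁ id)) ∘ (α⇒ ⊗₁ id)            ≈⟨ assoc ⟩
      α⇒ ∘ (((id ⊗₁ ρ⇒) ⊗₁ id) ∘ (α⇒ ⊗₁ id))            ≈⟨ refl⟩∘⟨ merge₁ ⟩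
      α⇒ ∘ (((id ⊗₁ ρ⇒) ∘ α⇒) ⊗₁ id) ∎

  unitorˡ≈ρ⇒ : unitorˡ⇒ {I} ≈ ρ⇒ {I}
  unitorˡ≈ρ⇒ = ρ-faithful (begin
      unitorˡ⇒ ⊗₁ id             ≈⟨ ≈-sym unitorˡ-α⇒ ⟩
      unitorˡ⇒ ∘ α⇒              ≈⟨ ≈-sym lam ⟩∘⟨refl ⟩
      (id ⊗₁ unitorˡ⇒) ∘ α⇒      ≈⟨ triangle ⟩
      ρ⇒ ⊗₁ id ∎)
    where
    lam : id ⊗₁ unitorˡ⇒ {I} ≈ unitorˡ⇒ {I ⊗₀ I}
    lam = cancel-isoˡ unitorˡ-isoˡ (≈-trans unitorˡ-natural ≈-refl)

  inv-unique : ∀ {X Y} {f g : Hom X Y} {f′ g′ : Hom Y X} → f ≈ g → f ∘ f′ ≈ id → g′ ∘ g ≈ id → f′ ≈ g′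
  inv-unique {f = f} {g} {f′} {g′} fg ff gg = begin
    f′ ≈⟨ insertˡ gg ⟩ g′ ∘ (g ∘ f′) ≈⟨ refl⟩∘⟨ (≈-sym fg ⟩∘⟨refl) ⟩ g′ ∘ (f ∘ f′) ≈⟨ cancelʳ ff ⟩ g′ ∎

  α⇐-ρ⇐ : ∀ {X Y} → α⇐ ∘ (id ⊗₁ ρ⇐) ≈ ρ⇐ {X ⊗₀ Y}
  α⇐-ρ⇐ = ≈-sym (inv-unique ρ⇒-α⇒ ρ-isoʳ (iso-comp α-isoˡ (iso⊗idˡ ρ-isoˡ)))

  triangle⇐ : ∀ {X Y} → α⇐ ∘ (id {X} ⊗₁ unitorˡ⇐ {Y}) ≈ ρ⇐ ⊗₁ id
  triangle⇐ = ≈-sym (inv-unique (≈-sym triangle) (iso⊗id ρ-isoʳ) (iso-comp α-isoˡ (iso⊗idˡ unitorˡ-isoˡ)))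

  unitorˡ⇐-α⇒ : ∀ {X Y} → unitorˡ⇐ {X ⊗₀ Y} ≈ α⇒ ∘ (unitorˡ⇐ ⊗₁ id)
  unitorˡ⇐-α⇒ = ≈-sym (≈-trans (refl⟩∘⟨ inverse) (cancelˡ α-isoʳ))
    where
    inverse : ∀ {X Y} → unitorˡ⇐ ⊗₁ id ≈ α⇐ ∘ unitorˡ⇐ {X ⊗₀ Y}
    inverse = inv-unique (≈-sym unitorˡ-α⇒) (iso⊗id unitorˡ-isoʳ) (iso-comp α-isoˡ unitorˡ-isoˡ)

  unitorˡ-σ : ∀ {X} → unitorˡ⇒ ∘ σ {X} {I} ≈ ρ⇒
  unitorˡ-σ {X} = ≈-sym (ρ-faithful (cancel-isoˡ σ-involutive chain))
    where
    chain : σ {X} {I} ∘ (ρ⇒ ⊗₁ id) ≈ σ ∘ ((unitorˡ⇒ ∘ σ) ⊗₁ id)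
    chain = begin
      σ ∘ (ρ⇒ ⊗₁ id)                       ≈⟨ refl⟩∘⟨ ≈-sym triangle ⟩
      σ ∘ ((id ⊗₁ unitorˡ⇒) ∘ α⇒)          ≈⟨ sym-assoc ⟩
      (σ ∘ (id ⊗₁ unitorˡ⇒)) ∘ α⇒          ≈⟨ σ-natural ⟩∘⟨refl ⟩
      ((unitorˡ⇒ ⊗₁ id) ∘ σ) ∘ α⇒          ≈⟨ (≈-sym unitorˡ-α⇒ ⟩∘⟨refl) ⟩∘⟨refl ⟩
      ((unitorˡ⇒ ∘ α⇒) ∘ σ) ∘ α⇒           ≈⟨ assoc ⟩
      (unitorˡ⇒ ∘ α⇒) ∘ (σ ∘ α⇒)           ≈⟨ assoc ⟩
      unitorˡ⇒ ∘ (α⇒ ∘ (σ ∘ α⇒))           ≈⟨ refl⟩∘⟨ hexagon ⟩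
      unitorˡ⇒ ∘ ((id ⊗₁ σ) ∘ (α⇒ ∘ (σ ⊗₁ id))) ≈⟨ sym-assoc ⟩
      (unitorˡ⇒ ∘ (id ⊗₁ σ)) ∘ (α⇒ ∘ (σ ⊗₁ id)) ≈⟨ unitorˡ-natural ⟩∘⟨refl ⟩
      (σ ∘ unitorˡ⇒) ∘ (α⇒ ∘ (σ ⊗₁ id))    ≈⟨ assoc ⟩
      σ ∘ (unitorˡ⇒ ∘ (α⇒ ∘ (σ ⊗₁ id)))    ≈⟨ refl⟩∘⟨ pullˡ unitorˡ-α⇒ ⟩
      σ ∘ ((unitorˡ⇒ ⊗₁ id) ∘ (σ ⊗₁ id))   ≈⟨ refl⟩∘⟨ merge₁ ⟩
      σ ∘ ((unitorˡ⇒ ∘ σ) ⊗₁ id) ∎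

  σ-ρ⇐ : ∀ {X} → σ {X} {I} ∘ ρ⇐ ≈ unitorˡ⇐
  σ-ρ⇐ = inv-unique ρ⇒-σ (≈-trans assoc (≈-trans (refl⟩∘⟨ cancelˡ σ-involutive) ρ-isoʳ)) unitorˡ-isoˡ
    where
    ρ⇒-σ : ∀ {X} → ρ⇒ ∘ σ {I} {X} ≈ unitorˡ⇒
    ρ⇒-σ = ≈-trans (≈-sym unitorˡ-σ ⟩∘⟨refl) (≈-trans assoc (cancelʳ σ-involutive))

  unitorˡ-σ-I : unitorˡ⇒ ∘ σ {I} {I} ≈ unitorˡ⇒
  unitorˡ-σ-I = ≈-trans unitorˡ-σ (≈-sym unitorˡ≈ρ⇒)

  id⊗σ-involutive : ∀ {W X Y} → (id {W} ⊗₁ σ {Y} {X}) ∘ (id ⊗₁ σ {X} {Y}) ≈ id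
  id⊗σ-involutive = iso⊗idˡ σ-involutive
  σ⊗id-involutive : ∀ {W X Y} → (σ {Y} {X} ⊗₁ id {W}) ∘ (σ {X} {Y} ⊗₁ id) ≈ id
  σ⊗id-involutive = iso⊗id σ-involutive

  σ-⊗ʳ : ∀ {X Y Z} → σ {X} {Y ⊗₀ Z} ≈ α⇐ ∘ ((id ⊗₁ σ) ∘ (α⇒ ∘ ((σ ⊗₁ id) ∘ α⇐)))
  σ-⊗ʳ = begin
    σ                                   ≈⟨ insertˡ α-isoˡ ⟩
    α⇐ ∘ (α⇒ ∘ σ)                       ≈⟨ refl⟩∘⟨ ≈-sym (cancelʳ α-isoʳ) ⟩
    α⇐ ∘ ((α⇒ ∘ σ) ∘ (α⇒ ∘ α⇐))         ≈⟨ refl⟩∘⟨ sym-assoc ⟩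
    α⇐ ∘ (((α⇒ ∘ σ) ∘ α⇒) ∘ α⇐)         ≈⟨ refl⟩∘⟨ (assoc ⟩∘⟨refl) ⟩
    α⇐ ∘ ((α⇒ ∘ (σ ∘ α⇒)) ∘ α⇐)         ≈⟨ refl⟩∘⟨ (hexagon ⟩∘⟨refl) ⟩
    α⇐ ∘ (((id ⊗₁ σ) ∘ (α⇒ ∘ (σ ⊗₁ id))) ∘ α⇐) ≈⟨ refl⟩∘⟨ assoc ⟩
    α⇐ ∘ ((id ⊗₁ σ) ∘ ((α⇒ ∘ (σ ⊗₁ id)) ∘ α⇐)) ≈⟨ refl⟩∘⟨ refl⟩∘⟨ assoc ⟩
    α⇐ ∘ ((id ⊗₁ σ) ∘ (α⇒ ∘ ((σ ⊗₁ id) ∘ α⇐))) ∎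

  σ-⊗ˡ : ∀ {P Q R} → σ {P ⊗₀ Q} {R} ≈ α⇒ ∘ ((σ {P} {R} ⊗₁ id) ∘ (α⇐ ∘ ((id ⊗₁ σ {Q} {R}) ∘ α⇒)))
  σ-⊗ˡ {P} {Q} {R} = ≈-sym (begin
    rhs                          ≈⟨ ≈-sym (cancelʳ σ-involutive) ⟩
    rhs ∘ (σ ∘ σ)                ≈⟨ sym-assoc ⟩
    (rhs ∘ σ {R} {P ⊗₀ Q}) ∘ σ   ≈⟨ (refl⟩∘⟨ σ-⊗ʳ) ⟩∘⟨refl ⟩
    (rhs ∘ (α⇐ ∘ ((id ⊗₁ σ) ∘ (α⇒ ∘ ((σ ⊗₁ id) ∘ α⇐))))) ∘ σ ≈⟨ iso-comp₅ α-isoʳ σ⊗id-involutive α-isoˡ id⊗σ-involutive α-isoʳ ⟩∘⟨refl ⟩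
    id ∘ σ                      ≈⟨ identityˡ ⟩
    σ ∎)
    where
    rhs = α⇒ ∘ ((σ {P} {R} ⊗₁ id) ∘ (α⇐ ∘ ((id ⊗₁ σ {Q} {R}) ∘ α⇒)))
    iso-comp₅ : ∀ {X₀ X₁ X₂ X₃ X₄ X₅}
             {a : Hom X₄ X₅} {a′ : Hom X₅ X₄} {b : Hom X₃ X₄} {b′ : Hom X₄ X₃}
             {c : Hom X₂ X₃} {c′ : Hom X₃ X₂} {d : Hom X₁ X₂} {d′ : Hom X₂ X₁}
             {f : Hom X₀ X₁} {f′ : Hom X₁ X₀} →
           a ∘ a′ ≈ id → b ∘ b′ ≈ id → c ∘ c′ ≈ id → d ∘ d′ ≈ id → f ∘ f′ ≈ id →
           (a ∘ (b ∘ (c ∘ (d ∘ f)))) ∘ (f′ ∘ (d′ ∘ (c′ ∘ (b′ ∘ a′)))) ≈ id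
    iso-comp₅ aa bb cc dd ff =
      ≈-trans (≈-refl ⟩∘⟨ ≈-trans sym-assoc (≈-trans sym-assoc sym-assoc))
       (iso-comp aa (iso-comp bb (iso-comp cc (iso-comp dd ff))))

  hexagon-α⇐ˡ : ∀ {X Z U} → α⇐ {Z} {U} {X} ∘ ((id ⊗₁ σ {X} {U}) ∘ α⇒ {Z} {X} {U})
                 ≈ σ {X} {Z ⊗₀ U} ∘ (α⇒ {X} {Z} {U} ∘ (σ {Z} {X} ⊗₁ id))
  hexagon-α⇐ˡ {X} {Z} {U} = begin
    α⇐ ∘ ((id ⊗₁ σ) ∘ α⇒)                                   ≈⟨ refl⟩∘⟨ ≈-sym (cancelʳ σ⊗id-involutive) ⟩
    α⇐ ∘ (((id ⊗₁ σ) ∘ α⇒) ∘ ((σ ⊗₁ id) ∘ (σ ⊗₁ id)))       ≈⟨ refl⟩∘⟨ sym-assoc ⟩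
    α⇐ ∘ ((((id ⊗₁ σ) ∘ α⇒) ∘ (σ ⊗₁ id)) ∘ (σ ⊗₁ id))       ≈⟨ refl⟩∘⟨ (assoc ⟩∘⟨refl) ⟩
    α⇐ ∘ (((id ⊗₁ σ) ∘ (α⇒ ∘ (σ ⊗₁ id))) ∘ (σ ⊗₁ id))       ≈⟨ refl⟩∘⟨ (≈-sym hexagon ⟩∘⟨refl) ⟩
    α⇐ ∘ ((α⇒ ∘ (σ ∘ α⇒)) ∘ (σ ⊗₁ id))                       ≈⟨ refl⟩∘⟨ assoc ⟩
    α⇐ ∘ (α⇒ ∘ ((σ ∘ α⇒) ∘ (σ ⊗₁ id)))                       ≈⟨ cancelˡ α-isoˡ ⟩
    (σ ∘ α⇒) ∘ (σ ⊗₁ id)                                     ≈⟨ assoc ⟩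
    σ ∘ (α⇒ ∘ (σ ⊗₁ id)) ∎

  hexagon-α⇐ʳ : ∀ {X Y Z} → (id ⊗₁ σ {Z} {X}) ∘ (α⇒ {Y} {Z} {X} ∘ σ {X} {Y ⊗₀ Z})
                 ≈ α⇒ {Y} {X} {Z} ∘ ((σ {X} {Y} ⊗₁ id) ∘ α⇐ {X} {Y} {Z})
  hexagon-α⇐ʳ {X} {Y} {Z} = begin
    (id ⊗₁ σ) ∘ (α⇒ ∘ σ)                                   ≈⟨ refl⟩∘⟨ ≈-sym (cancelʳ α-isoʳ) ⟩
    (id ⊗₁ σ) ∘ ((α⇒ ∘ σ) ∘ (α⇒ ∘ α⇐))                     ≈⟨ refl⟩∘⟨ sym-assoc ⟩
    (id ⊗₁ σ) ∘ (((α⇒ ∘ σ) ∘ α⇒) ∘ α⇐)                     ≈⟨ refl⟩∘⟨ (assoc ⟩∘⟨refl) ⟩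
    (id ⊗₁ σ) ∘ ((α⇒ ∘ (σ ∘ α⇒)) ∘ α⇐)                     ≈⟨ refl⟩∘⟨ (hexagon ⟩∘⟨refl) ⟩
    (id ⊗₁ σ) ∘ (((id ⊗₁ σ) ∘ (α⇒ ∘ (σ ⊗₁ id))) ∘ α⇐)     ≈⟨ refl⟩∘⟨ assoc ⟩
    (id ⊗₁ σ) ∘ ((id ⊗₁ σ) ∘ ((α⇒ ∘ (σ ⊗₁ id)) ∘ α⇐))     ≈⟨ cancelˡ id⊗σ-involutive ⟩
    (α⇒ ∘ (σ ⊗₁ id)) ∘ α⇐                                 ≈⟨ assoc ⟩
    α⇒ ∘ ((σ ⊗₁ id) ∘ α⇐) ∎

  σ-⊗ˡ′ : ∀ {x y P} → α⇒ {P} {x} {y} ∘ (σ {y} {P ⊗₀ x} ∘ ((id ⊗₁ σ {x} {P}) ∘ (α⇒ {y} {x} {P} ∘ (σ {x} {y} ⊗₁ id))))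
                   ≈ σ {x ⊗₀ y} {P}
  σ-⊗ˡ′ {x} {y} {P} = begin
    α⇒ ∘ (σ ∘ ((id ⊗₁ σ) ∘ (α⇒ ∘ (σ ⊗₁ id))))        ≈⟨ sym-assoc ⟩
    (α⇒ ∘ σ) ∘ ((id ⊗₁ σ) ∘ (α⇒ ∘ (σ ⊗₁ id)))        ≈⟨ α⇒-σ ⟩∘⟨refl ⟩
    (((id ⊗₁ σ) ∘ (α⇒ ∘ (σ ⊗₁ id))) ∘ α⇐) ∘ ((id ⊗₁ σ) ∘ (α⇒ ∘ (σ ⊗₁ id))) ≈⟨ assoc ⟩
    ((id ⊗₁ σ) ∘ (α⇒ ∘ (σ ⊗₁ id))) ∘ (α⇐ ∘ ((id ⊗₁ σ) ∘ (α⇒ ∘ (σ ⊗₁ id)))) ≈⟨ assoc ⟩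
    (id ⊗₁ σ) ∘ ((α⇒ ∘ (σ ⊗₁ id)) ∘ (α⇐ ∘ ((id ⊗₁ σ) ∘ (α⇒ ∘ (σ ⊗₁ id))))) ≈⟨ refl⟩∘⟨ assoc ⟩
    (id ⊗₁ σ) ∘ (α⇒ ∘ ((σ ⊗₁ id) ∘ (α⇐ ∘ ((id ⊗₁ σ) ∘ (α⇒ ∘ (σ ⊗₁ id)))))) ≈⟨ refl⟩∘⟨ ≈-sym assoc₄ ⟩
    (id ⊗₁ σ) ∘ ((α⇒ ∘ ((σ ⊗₁ id) ∘ (α⇐ ∘ ((id ⊗₁ σ) ∘ α⇒)))) ∘ (σ ⊗₁ id)) ≈⟨ refl⟩∘⟨ (≈-sym σ-⊗ˡ ⟩∘⟨refl) ⟩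
    (id ⊗₁ σ {y} {x}) ∘ (σ ∘ (σ ⊗₁ id))                ≈⟨ refl⟩∘⟨ σ-natural ⟩
    (id ⊗₁ σ {y} {x}) ∘ ((id ⊗₁ σ) ∘ σ)                ≈⟨ cancelˡ id⊗σ-involutive ⟩
    σ ∎
    where
    α⇒-σ : α⇒ {P} {x} {y} ∘ σ {y} {P ⊗₀ x} ≈ ((id ⊗₁ σ) ∘ (α⇒ ∘ (σ ⊗₁ id))) ∘ α⇐
    α⇒-σ = begin
      α⇒ ∘ σ                         ≈⟨ ≈-sym (cancelʳ α-isoʳ) ⟩
      (α⇒ ∘ σ) ∘ (α⇒ ∘ α⇐)           ≈⟨ sym-assoc ⟩
      ((α⇒ ∘ σ) ∘ α⇒) ∘ α⇐           ≈⟨ assoc ⟩∘⟨refl ⟩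
      (α⇒ ∘ (σ ∘ α⇒)) ∘ α⇐           ≈⟨ hexagon ⟩∘⟨refl ⟩
      ((id ⊗₁ σ) ∘ (α⇒ ∘ (σ ⊗₁ id))) ∘ α⇐ ∎

  pentagon-∘ : ∀ {V W X Y Z} {k : Hom V (((W ⊗₀ X) ⊗₀ Y) ⊗₀ Z)} →
               (id ⊗₁ α⇒) ∘ (α⇒ ∘ ((α⇒ ⊗₁ id) ∘ k)) ≈ α⇒ ∘ (α⇒ ∘ k)
  pentagon-∘ {k = k} = begin
    (id ⊗₁ α⇒) ∘ (α⇒ ∘ ((α⇒ ⊗₁ id) ∘ k))   ≈⟨ refl⟩∘⟨ sym-assoc ⟩
    (id ⊗₁ α⇒) ∘ ((α⇒ ∘ (α⇒ ⊗₁ id)) ∘ k)   ≈⟨ sym-assoc ⟩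
    ((id ⊗₁ α⇒) ∘ (α⇒ ∘ (α⇒ ⊗₁ id))) ∘ k   ≈⟨ pentagon ⟩∘⟨refl ⟩
    (α⇒ ∘ α⇒) ∘ k                          ≈⟨ assoc ⟩
    α⇒ ∘ (α⇒ ∘ k) ∎

  permutation-coherence : ∀ {x y z u} →
    α⇒ {z ⊗₀ u} {x} {y} ∘ (σ {y} {(z ⊗₀ u) ⊗₀ x} ∘ ((id {y} ⊗₁ (α⇐ {z} {u} {x} ∘ (id {z} ⊗₁ σ {x} {u})))
       ∘ (α⇒ {y} {z} {x ⊗₀ u} ∘ (α⇒ {y ⊗₀ z} {x} {u} ∘ (σ {x} {y ⊗₀ z} ⊗₁ id {u})))))
    ≈ σ {x ⊗₀ y} {z ⊗₀ u} ∘ (α⇒ {x ⊗₀ y} {z} {u} ∘ (α⇐ {x} {y} {z} ⊗₁ id {u}))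
  permutation-coherence {x} {y} {z} {u} = begin
    α⇒ ∘ (σ ∘ (T ∘ (α⇒ ∘ (α⇒ ∘ S))))                                  ≈⟨ refl⟩∘⟨ refl⟩∘⟨ refl⟩∘⟨ sym-assoc ⟩
    α⇒ ∘ (σ ∘ (T ∘ ((α⇒ ∘ α⇒) ∘ S)))                                  ≈⟨ refl⟩∘⟨ refl⟩∘⟨ refl⟩∘⟨ (≈-sym pentagon ⟩∘⟨refl) ⟩
    α⇒ ∘ (σ ∘ (T ∘ (((id ⊗₁ α⇒) ∘ (α⇒ ∘ (α⇒ ⊗₁ id))) ∘ S)))           ≈⟨ refl⟩∘⟨ refl⟩∘⟨ refl⟩∘⟨ ≈-trans assoc (refl⟩∘⟨ assoc) ⟩
    α⇒ ∘ (σ ∘ (T ∘ ((id ⊗₁ α⇒) ∘ (α⇒ ∘ ((α⇒ ⊗₁ id) ∘ S)))))           ≈⟨ refl⟩∘⟨ refl⟩∘⟨ pullˡ inner-hexagon ⟩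
    α⇒ ∘ (σ ∘ (((id ⊗₁ σ) ∘ ((id ⊗₁ α⇒) ∘ (id ⊗₁ (σ ⊗₁ id)))) ∘ (α⇒ ∘ ((α⇒ ⊗₁ id) ∘ S)))) ≈⟨ refl⟩∘⟨ refl⟩∘⟨ ≈-trans assoc (refl⟩∘⟨ assoc) ⟩
    α⇒ ∘ (σ ∘ ((id ⊗₁ σ) ∘ ((id ⊗₁ α⇒) ∘ ((id ⊗₁ (σ ⊗₁ id)) ∘ (α⇒ ∘ ((α⇒ ⊗₁ id) ∘ S)))))) ≈⟨ refl⟩∘⟨ refl⟩∘⟨ refl⟩∘⟨ refl⟩∘⟨ pullˡ (≈-sym α-natural) ⟩
    α⇒ ∘ (σ ∘ ((id ⊗₁ σ) ∘ ((id ⊗₁ α⇒) ∘ ((α⇒ ∘ ((id ⊗₁ σ) ⊗₁ id)) ∘ ((α⇒ ⊗₁ id) ∘ S))))) ≈⟨ refl⟩∘⟨ refl⟩∘⟨ refl⟩∘⟨ refl⟩∘⟨ assoc ⟩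
    α⇒ ∘ (σ ∘ ((id ⊗₁ σ) ∘ ((id ⊗₁ α⇒) ∘ (α⇒ ∘ (((id ⊗₁ σ) ⊗₁ id) ∘ ((α⇒ ⊗₁ id) ∘ S)))))) ≈⟨ refl⟩∘⟨ refl⟩∘⟨ refl⟩∘⟨ refl⟩∘⟨ refl⟩∘⟨ outer-hexagon ⟩
    α⇒ ∘ (σ ∘ ((id ⊗₁ σ) ∘ ((id ⊗₁ α⇒) ∘ (α⇒ ∘ ((α⇒ ⊗₁ id) ∘ (((σ ⊗₁ id) ⊗₁ id) ∘ (α⇐ ⊗₁ id))))))) ≈⟨ refl⟩∘⟨ refl⟩∘⟨ refl⟩∘⟨ pentagon-∘ ⟩
    α⇒ ∘ (σ ∘ ((id ⊗₁ σ) ∘ (α⇒ ∘ (α⇒ ∘ (((σ ⊗₁ id) ⊗₁ id) ∘ (α⇐ ⊗₁ id)))))) ≈⟨ refl⟩∘⟨ refl⟩∘⟨ refl⟩∘⟨ refl⟩∘⟨ ≈-trans (pullˡ α⇒-σ⊗id) assoc ⟩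
    α⇒ ∘ (σ ∘ ((id ⊗₁ σ) ∘ (α⇒ ∘ ((σ ⊗₁ id) ∘ (α⇒ ∘ (α⇐ ⊗₁ id))))))  ≈⟨ assoc₄ ⟨
    (α⇒ ∘ (σ ∘ ((id ⊗₁ σ) ∘ (α⇒ ∘ (σ ⊗₁ id))))) ∘ (α⇒ ∘ (α⇐ ⊗₁ id)) ≈⟨ σ-⊗ˡ′ ⟩∘⟨refl ⟩
    σ ∘ (α⇒ ∘ (α⇐ ⊗₁ id)) ∎
    where
    T = id {y} ⊗₁ (α⇐ {z} {u} {x} ∘ (id {z} ⊗₁ σ {x} {u}))
    S = σ {x} {y ⊗₀ z} ⊗₁ id {u}
    inner-hexagon : T ∘ (id ⊗₁ α⇒ {z} {x} {u}) ≈ (id ⊗₁ σ {x} {z ⊗₀ u}) ∘ ((id ⊗₁ α⇒) ∘ (id ⊗₁ (σ {z} {x} ⊗₁ id)))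
    inner-hexagon = begin
      T ∘ (id ⊗₁ α⇒)                                ≈⟨ merge₂ ⟩
      id ⊗₁ ((α⇐ ∘ (id ⊗₁ σ)) ∘ α⇒)                 ≈⟨ ≈-refl ⟩⊗⟨ ≈-trans assoc hexagon-α⇐ˡ ⟩
      id ⊗₁ (σ ∘ (α⇒ ∘ (σ ⊗₁ id)))                  ≈⟨ split₂ ⟩
      (id ⊗₁ σ) ∘ (id ⊗₁ (α⇒ ∘ (σ ⊗₁ id)))          ≈⟨ refl⟩∘⟨ split₂ ⟩
      (id ⊗₁ σ) ∘ ((id ⊗₁ α⇒) ∘ (id ⊗₁ (σ ⊗₁ id))) ∎
    outer-hexagon : ((id {y} ⊗₁ σ {z} {x}) ⊗₁ id {u}) ∘ ((α⇒ ⊗₁ id) ∘ S) ≈ (α⇒ ⊗₁ id) ∘ (((σ ⊗₁ id) ⊗₁ id) ∘ (α⇐ ⊗₁ id))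
    outer-hexagon = begin
      ((id ⊗₁ σ) ⊗₁ id) ∘ ((α⇒ ⊗₁ id) ∘ (σ ⊗₁ id))   ≈⟨ refl⟩∘⟨ merge₁ ⟩
      ((id ⊗₁ σ) ⊗₁ id) ∘ ((α⇒ ∘ σ) ⊗₁ id)          ≈⟨ merge₁ ⟩
      ((id ⊗₁ σ) ∘ (α⇒ ∘ σ)) ⊗₁ id                  ≈⟨ hexagon-α⇐ʳ ⟩⊗⟨ ≈-refl ⟩
      (α⇒ ∘ ((σ ⊗₁ id) ∘ α⇐)) ⊗₁ id                 ≈⟨ split₁ ⟩
      (α⇒ ⊗₁ id) ∘ (((σ ⊗₁ id) ∘ α⇐) ⊗₁ id)         ≈⟨ refl⟩∘⟨ split₁ ⟩
      (α⇒ ⊗₁ id) ∘ (((σ ⊗₁ id) ⊗₁ id) ∘ (α⇐ ⊗₁ id)) ∎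
    α⇒-σ⊗id : α⇒ {y ⊗₀ x} {z} {u} ∘ ((σ {x} {y} ⊗₁ id) ⊗₁ id) ≈ (σ ⊗₁ id) ∘ α⇒
    α⇒-σ⊗id = ≈-trans α-natural ((≈-refl ⟩⊗⟨ ⊗-id) ⟩∘⟨refl)

  curry-cong : ∀ {X Y Z} {f g : Hom (X ⊗₀ Y) Z} → f ≈ g → curry f ≈ curry g
  curry-cong p = curry-unique (≈-trans ev-curry p)

  curry-∘ : ∀ {X Y Y′ Z} {f : Hom (X ⊗₀ Y) Z} {g : Hom Y′ Y} → curry f ∘ g ≈ curry (f ∘ (id ⊗₁ g))
  curry-∘ = curry-unique (≈-trans (refl⟩∘⟨ split₂) (pullˡ ev-curry))

  ev-ext : ∀ {X Y Z} {f g : Hom Y [ X , Z ]} → ev ∘ (id ⊗₁ f) ≈ ev ∘ (id ⊗₁ g) → f ≈ g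
  ev-ext p = ≈-trans (curry-unique p) (≈-sym (curry-unique ≈-refl))

  ev-id : ∀ {X Z} → ev {X} {Z} ∘ (id ⊗₁ id) ≈ ev
  ev-id = ≈-trans (refl⟩∘⟨ ⊗-id) identityʳ

  ididˡ : ∀ {X Y Z W} {g : Hom Z W} → (id {X} ⊗₁ id {Y}) ⊗₁ g ≈ id ⊗₁ g
  ididˡ = ⊗-id ⟩⊗⟨ ≈-refl
  ididʳ : ∀ {X Y Z W} {g : Hom Z W} → g ⊗₁ (id {X} ⊗₁ id {Y}) ≈ g ⊗₁ id
  ididʳ = ≈-refl ⟩⊗⟨ ⊗-id

  pentagon-α⇐ : ∀ {X Y Z U} →
    α⇐ {X} {Y} {Z ⊗₀ U} ∘ (id ⊗₁ α⇒ {Y} {Z} {U}) ≈ α⇒ {X ⊗₀ Y} {Z} {U} ∘ ((α⇐ ⊗₁ id) ∘ α⇐ {X} {Y ⊗₀ Z} {U})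
  pentagon-α⇐ = begin
    α⇐ ∘ (id ⊗₁ α⇒)                                             ≈⟨ refl⟩∘⟨ ≈-sym identityʳ ⟩
    α⇐ ∘ ((id ⊗₁ α⇒) ∘ id)                                      ≈⟨ refl⟩∘⟨ refl⟩∘⟨ ≈-sym (iso-comp α-isoʳ (iso⊗id α-isoʳ)) ⟩
    α⇐ ∘ ((id ⊗₁ α⇒) ∘ ((α⇒ ∘ (α⇒ ⊗₁ id)) ∘ ((α⇐ ⊗₁ id) ∘ α⇐))) ≈⟨ refl⟩∘⟨ sym-assoc ⟩
    α⇐ ∘ (((id ⊗₁ α⇒) ∘ (α⇒ ∘ (α⇒ ⊗₁ id))) ∘ ((α⇐ ⊗₁ id) ∘ α⇐)) ≈⟨ refl⟩∘⟨ (pentagon ⟩∘⟨refl) ⟩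
    α⇐ ∘ ((α⇒ ∘ α⇒) ∘ ((α⇐ ⊗₁ id) ∘ α⇐))                        ≈⟨ refl⟩∘⟨ assoc ⟩
    α⇐ ∘ (α⇒ ∘ (α⇒ ∘ ((α⇐ ⊗₁ id) ∘ α⇐)))                        ≈⟨ cancelˡ α-isoˡ ⟩
    α⇒ ∘ ((α⇐ ⊗₁ id) ∘ α⇐) ∎

  unitorˡ-⊗-natural : ∀ {X Y Z} {f : Hom (X ⊗₀ Y) Z} →
                      f ∘ (unitorˡ⇒ ⊗₁ id) ≈ unitorˡ⇒ ∘ ((id ⊗₁ f) ∘ α⇒)
  unitorˡ-⊗-natural {f = f} = begin
    f ∘ (unitorˡ⇒ ⊗₁ id)          ≈⟨ refl⟩∘⟨ ≈-sym unitorˡ-α⇒ ⟩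
    f ∘ (unitorˡ⇒ ∘ α⇒)           ≈⟨ pullˡ (≈-sym unitorˡ-natural) ⟩
    (unitorˡ⇒ ∘ (id ⊗₁ f)) ∘ α⇒   ≈⟨ assoc ⟩
    unitorˡ⇒ ∘ ((id ⊗₁ f) ∘ α⇒) ∎

  ρ⇒-⊗-natural : ∀ {X Y Z} {f : Hom (X ⊗₀ Y) Z} → f ∘ (id ⊗₁ ρ⇒) ≈ ρ⇒ ∘ ((f ⊗₁ id) ∘ α⇐)
  ρ⇒-⊗-natural {f = f} = begin
    f ∘ (id ⊗₁ ρ⇒)            ≈⟨ refl⟩∘⟨ ≈-sym (≈-trans (ρ⇒-α⇒ ⟩∘⟨refl) (≈-trans assoc (cancelʳ α-isoʳ))) ⟩
    f ∘ (ρ⇒ ∘ α⇐)             ≈⟨ pullˡ (≈-sym ρ-natural) ⟩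
    (ρ⇒ ∘ (f ⊗₁ id)) ∘ α⇐     ≈⟨ assoc ⟩
    ρ⇒ ∘ ((f ⊗₁ id) ∘ α⇐) ∎

module Frobenius⇒Adjunction {o h e : Level} (V : SymMonClosed o h e) where
  open SymMonClosed V
  open Notions V
  open Properties V

  internalId : ∀ {A} → Hom I [ A , A ]
  internalId = curry ρ⇒

  intComp-identityʳ : ∀ {A} → intComp A ∘ ((id ⊗₁ internalId) ∘ ρ⇐) ≈ id
  intComp-identityʳ {A} = ev-ext (begin
    ev ∘ (id ⊗₁ (μ ∘ ((id ⊗₁ internalId) ∘ ρ⇐)))                  ≈⟨ refl⟩∘⟨ split₂ ⟩
    ev ∘ ((id ⊗₁ μ) ∘ (id ⊗₁ ((id ⊗₁ internalId) ∘ ρ⇐)))          ≈⟨ pullˡ ev-curry ⟩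
    (ev ∘ ((ev ⊗₁ id) ∘ α⇐)) ∘ (id ⊗₁ ((id ⊗₁ internalId) ∘ ρ⇐))  ≈⟨ ≈-trans assoc (refl⟩∘⟨ assoc) ⟩
    ev ∘ ((ev ⊗₁ id) ∘ (α⇐ ∘ (id ⊗₁ ((id ⊗₁ internalId) ∘ ρ⇐))))  ≈⟨ refl⟩∘⟨ refl⟩∘⟨ refl⟩∘⟨ split₂ ⟩
    ev ∘ ((ev ⊗₁ id) ∘ (α⇐ ∘ ((id ⊗₁ (id ⊗₁ internalId)) ∘ (id ⊗₁ ρ⇐)))) ≈⟨ refl⟩∘⟨ refl⟩∘⟨ pullˡ α⇐-natural ⟩
    ev ∘ ((ev ⊗₁ id) ∘ ((((id ⊗₁ id) ⊗₁ internalId) ∘ α⇐) ∘ (id ⊗₁ ρ⇐))) ≈⟨ refl⟩∘⟨ refl⟩∘⟨ assoc ⟩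
    ev ∘ ((ev ⊗₁ id) ∘ (((id ⊗₁ id) ⊗₁ internalId) ∘ (α⇐ ∘ (id ⊗₁ ρ⇐)))) ≈⟨ refl⟩∘⟨ refl⟩∘⟨ (ididˡ ⟩∘⟨ α⇐-ρ⇐) ⟩
    ev ∘ ((ev ⊗₁ id) ∘ ((id ⊗₁ internalId) ∘ ρ⇐))                 ≈⟨ refl⟩∘⟨ pullˡ interchange ⟩
    ev ∘ (((id ⊗₁ internalId) ∘ (ev ⊗₁ id)) ∘ ρ⇐)                 ≈⟨ refl⟩∘⟨ assoc ⟩
    ev ∘ ((id ⊗₁ internalId) ∘ ((ev ⊗₁ id) ∘ ρ⇐))                 ≈⟨ pullˡ ev-curry ⟩
    ρ⇒ ∘ ((ev ⊗₁ id) ∘ ρ⇐)                                         ≈⟨ pullˡ ρ-natural ⟩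
    (ev ∘ ρ⇒) ∘ ρ⇐                                                 ≈⟨ ≈-trans assoc (cancelʳ ρ-isoʳ) ⟩
    ev                                                             ≈⟨ ev-id ⟨
    ev ∘ (id ⊗₁ id) ∎)
    where
    μ = intComp A

  module FrobeniusTrace {E B : Obj} {ε : Hom (E ⊗₀ B) I} {μ : Hom (E ⊗₀ E) E} {l r : Hom E B}
           (frobenius : IsFrobeniusStructure E B ε μ l r)
           (u : Hom I E) (μ-identityʳ : μ ∘ ((id ⊗₁ u) ∘ ρ⇐) ≈ id) where
    open IsFrobeniusStructure frobenius
    open IsDualPairing dualPairing

    trace : Hom E I
    trace = ε ∘ ((id ⊗₁ (l ∘ u)) ∘ ρ⇐)

    insertUnit : Hom (E ⊗₀ E) (E ⊗₀ (E ⊗₀ E))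
    insertUnit = id ⊗₁ ((u ⊗₁ id) ∘ unitorˡ⇐)

    ◁-insertUnit : ε ∘ ((id ⊗₁ ◁ dualPairing μ) ∘ ((id ⊗₁ (id ⊗₁ r)) ∘ insertUnit)) ≈ ε ∘ (id ⊗₁ r)
    ◁-insertUnit = begin
      ε ∘ ((id ⊗₁ ◁ dualPairing μ) ∘ ((id ⊗₁ (id ⊗₁ r)) ∘ insertUnit)) ≈⟨ pullˡ ◁-spec ⟩
      (ε ∘ ((μ ⊗₁ id) ∘ α⇐)) ∘ ((id ⊗₁ (id ⊗₁ r)) ∘ insertUnit)         ≈⟨ ≈-trans assoc (refl⟩∘⟨ assoc) ⟩
      ε ∘ ((μ ⊗₁ id) ∘ (α⇐ ∘ ((id ⊗₁ (id ⊗₁ r)) ∘ insertUnit)))         ≈⟨ refl⟩∘⟨ refl⟩∘⟨ refl⟩∘⟨ insert ⟩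
      ε ∘ ((μ ⊗₁ id) ∘ (α⇐ ∘ ((id ⊗₁ (u ⊗₁ r)) ∘ (id ⊗₁ unitorˡ⇐))))   ≈⟨ refl⟩∘⟨ refl⟩∘⟨ pullˡ α⇐-natural ⟩
      ε ∘ ((μ ⊗₁ id) ∘ ((((id ⊗₁ u) ⊗₁ r) ∘ α⇐) ∘ (id ⊗₁ unitorˡ⇐)))   ≈⟨ refl⟩∘⟨ refl⟩∘⟨ ≈-trans assoc (refl⟩∘⟨ triangle⇐) ⟩
      ε ∘ ((μ ⊗₁ id) ∘ (((id ⊗₁ u) ⊗₁ r) ∘ (ρ⇐ ⊗₁ id)))                ≈⟨ refl⟩∘⟨ refl⟩∘⟨ merge ⟩
      ε ∘ ((μ ⊗₁ id) ∘ (((id ⊗₁ u) ∘ ρ⇐) ⊗₁ (r ∘ id)))                  ≈⟨ refl⟩∘⟨ merge ⟩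
      ε ∘ ((μ ∘ ((id ⊗₁ u) ∘ ρ⇐)) ⊗₁ (id ∘ (r ∘ id)))                   ≈⟨ refl⟩∘⟨ (μ-identityʳ ⟩⊗⟨ ≈-trans identityˡ identityʳ) ⟩
      ε ∘ (id ⊗₁ r) ∎
      where
      ◁-spec : ε ∘ (id ⊗₁ ◁ dualPairing μ) ≈ ε ∘ ((μ ⊗₁ id) ∘ α⇐)
      ◁-spec = proj₂ (surjʳ (E ⊗₀ B) (ε ∘ ((μ ⊗₁ id {B}) ∘ α⇐)))
      insert : (id ⊗₁ (id ⊗₁ r)) ∘ insertUnit ≈ (id ⊗₁ (u ⊗₁ r)) ∘ (id ⊗₁ unitorˡ⇐)
      insert = ≈-trans merge₂ (≈-trans (≈-refl ⟩⊗⟨ pullˡ (≈-sym ⊗-as-ʳˡ)) split₂)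

    ▷-insertUnit : ε ∘ ((id ⊗₁ ▷ dualPairing μ) ∘ ((id ⊗₁ (l ⊗₁ id)) ∘ insertUnit)) ≈ trace ∘ (μ ∘ σ)
    ▷-insertUnit = begin
      ε ∘ ((id ⊗₁ ▷ dualPairing μ) ∘ ((id ⊗₁ (l ⊗₁ id)) ∘ insertUnit))  ≈⟨ pullˡ ▷-spec ⟩
      (ε ∘ ((μ ⊗₁ id) ∘ (α⇐ ∘ (σ ∘ α⇐)))) ∘ ((id ⊗₁ (l ⊗₁ id)) ∘ insertUnit) ≈⟨ ≈-trans assoc (refl⟩∘⟨ ≈-trans assoc (refl⟩∘⟨ ≈-trans assoc (refl⟩∘⟨ assoc))) ⟩
      ε ∘ ((μ ⊗₁ id) ∘ (α⇐ ∘ (σ ∘ (α⇐ ∘ ((id ⊗₁ (l ⊗₁ id)) ∘ insertUnit))))) ≈⟨ refl⟩∘⟨ refl⟩∘⟨ refl⟩∘⟨ refl⟩∘⟨ insert ⟩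
      ε ∘ ((μ ⊗₁ id) ∘ (α⇐ ∘ (σ ∘ (((id ⊗₁ lu) ∘ ρ⇐) ⊗₁ id))))  ≈⟨ refl⟩∘⟨ refl⟩∘⟨ refl⟩∘⟨ σ-natural ⟩
      ε ∘ ((μ ⊗₁ id) ∘ (α⇐ ∘ ((id ⊗₁ ((id ⊗₁ lu) ∘ ρ⇐)) ∘ σ)))  ≈⟨ refl⟩∘⟨ refl⟩∘⟨ refl⟩∘⟨ (split₂ ⟩∘⟨refl) ⟩
      ε ∘ ((μ ⊗₁ id) ∘ (α⇐ ∘ (((id ⊗₁ (id ⊗₁ lu)) ∘ (id ⊗₁ ρ⇐)) ∘ σ))) ≈⟨ refl⟩∘⟨ refl⟩∘⟨ refl⟩∘⟨ assoc ⟩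
      ε ∘ ((μ ⊗₁ id) ∘ (α⇐ ∘ ((id ⊗₁ (id ⊗₁ lu)) ∘ ((id ⊗₁ ρ⇐) ∘ σ)))) ≈⟨ refl⟩∘⟨ refl⟩∘⟨ pullˡ α⇐-natural ⟩
      ε ∘ ((μ ⊗₁ id) ∘ ((((id ⊗₁ id) ⊗₁ lu) ∘ α⇐) ∘ ((id ⊗₁ ρ⇐) ∘ σ))) ≈⟨ refl⟩∘⟨ refl⟩∘⟨ ≈-trans assoc (refl⟩∘⟨ pullˡ α⇐-ρ⇐) ⟩
      ε ∘ ((μ ⊗₁ id) ∘ (((id ⊗₁ id) ⊗₁ lu) ∘ (ρ⇐ ∘ σ)))         ≈⟨ refl⟩∘⟨ pullˡ (≈-trans (refl⟩∘⟨ ididˡ) interchange) ⟩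
      ε ∘ (((id ⊗₁ lu) ∘ (μ ⊗₁ id)) ∘ (ρ⇐ ∘ σ))                  ≈⟨ refl⟩∘⟨ ≈-trans assoc (refl⟩∘⟨ pullˡ (≈-sym ρ⇐-natural)) ⟩
      ε ∘ ((id ⊗₁ lu) ∘ ((ρ⇐ ∘ μ) ∘ σ))                          ≈⟨ refl⟩∘⟨ refl⟩∘⟨ assoc ⟩
      ε ∘ ((id ⊗₁ lu) ∘ (ρ⇐ ∘ (μ ∘ σ)))                          ≈⟨ ≈-trans (refl⟩∘⟨ sym-assoc) sym-assoc ⟩
      trace ∘ (μ ∘ σ) ∎
      where
      lu = l ∘ u
      ▷-spec : ε ∘ (id ⊗₁ ▷ dualPairing μ) ≈ ε ∘ ((μ ⊗₁ id) ∘ (α⇐ ∘ (σ {E ⊗₀ B} {E} ∘ α⇐)))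
      ▷-spec = proj₂ (surjʳ (B ⊗₀ E) (ε ∘ ((μ ⊗₁ id {B}) ∘ (α⇐ ∘ (σ {E ⊗₀ B} {E} ∘ α⇐)))))
      insert : α⇐ ∘ ((id ⊗₁ (l ⊗₁ id)) ∘ insertUnit) ≈ ((id ⊗₁ lu) ∘ ρ⇐) ⊗₁ id {E}
      insert = begin
        α⇐ ∘ ((id ⊗₁ (l ⊗₁ id)) ∘ (id ⊗₁ ((u ⊗₁ id) ∘ unitorˡ⇐))) ≈⟨ refl⟩∘⟨ merge₂ ⟩
        α⇐ ∘ (id ⊗₁ ((l ⊗₁ id) ∘ ((u ⊗₁ id) ∘ unitorˡ⇐)))          ≈⟨ refl⟩∘⟨ (≈-refl ⟩⊗⟨ pullˡ merge₁) ⟩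
        α⇐ ∘ (id ⊗₁ ((lu ⊗₁ id) ∘ unitorˡ⇐))                        ≈⟨ refl⟩∘⟨ split₂ ⟩
        α⇐ ∘ ((id ⊗₁ (lu ⊗₁ id)) ∘ (id ⊗₁ unitorˡ⇐))               ≈⟨ pullˡ α⇐-natural ⟩
        (((id ⊗₁ lu) ⊗₁ id) ∘ α⇐) ∘ (id ⊗₁ unitorˡ⇐)               ≈⟨ ≈-trans assoc (refl⟩∘⟨ triangle⇐) ⟩
        ((id ⊗₁ lu) ⊗₁ id) ∘ (ρ⇐ ⊗₁ id)                             ≈⟨ merge₁ ⟩
        ((id ⊗₁ lu) ∘ ρ⇐) ⊗₁ id ∎

    -- Inserting the unit u and moving r across the product by ◁ ∘ (E ⊗ r) = ▷ ∘ (l ⊗ E).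
    pairing≈trace : ε ∘ (id ⊗₁ r) ≈ trace ∘ (μ ∘ σ)
    pairing≈trace = begin
      ε ∘ (id ⊗₁ r)                                                      ≈⟨ ◁-insertUnit ⟨
      ε ∘ ((id ⊗₁ ◁ dualPairing μ) ∘ ((id ⊗₁ (id ⊗₁ r)) ∘ insertUnit))   ≈⟨ refl⟩∘⟨ pullˡ (≈-trans merge₂ (≈-trans (≈-refl ⟩⊗⟨ ◁▷-lr) split₂)) ⟩
      ε ∘ (((id ⊗₁ ▷ dualPairing μ) ∘ (id ⊗₁ (l ⊗₁ id))) ∘ insertUnit)   ≈⟨ refl⟩∘⟨ assoc ⟩
      ε ∘ ((id ⊗₁ ▷ dualPairing μ) ∘ ((id ⊗₁ (l ⊗₁ id)) ∘ insertUnit))   ≈⟨ ▷-insertUnit ⟩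
      trace ∘ (μ ∘ σ) ∎

    trace-nondegenerate : ∀ {X} (k : Hom (X ⊗₀ E) I) →
                          Σ[ g ∈ Hom X E ] (trace ∘ (μ ∘ (σ ∘ (g ⊗₁ id))) ≈ k)
    trace-nondegenerate {X} k = g , (begin
      trace ∘ (μ ∘ (σ ∘ (g ⊗₁ id)))             ≈⟨ ≈-trans (refl⟩∘⟨ sym-assoc) sym-assoc ⟩
      (trace ∘ (μ ∘ σ)) ∘ (g ⊗₁ id)             ≈⟨ ≈-sym pairing≈trace ⟩∘⟨refl ⟩
      (ε ∘ (id ⊗₁ r)) ∘ (g ⊗₁ id)               ≈⟨ assoc ⟩
      ε ∘ ((id ⊗₁ r) ∘ (g ⊗₁ id))               ≈⟨ refl⟩∘⟨ interchange ⟨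
      ε ∘ ((g ⊗₁ id) ∘ (id ⊗₁ r))               ≈⟨ pullˡ (proj₂ (surjˡ X (k ∘ (id ⊗₁ r⁻¹)))) ⟩
      (k ∘ (id ⊗₁ r⁻¹)) ∘ (id ⊗₁ r)             ≈⟨ ≈-trans assoc (refl⟩∘⟨ ≈-trans merge₂ (≈-refl ⟩⊗⟨ proj₁ (proj₂ r-iso))) ⟩
      k ∘ (id ⊗₁ id)                            ≈⟨ ≈-trans (refl⟩∘⟨ ⊗-id) identityʳ ⟩
      k ∎)
      where
      r⁻¹ = proj₁ r-iso
      g = proj₁ (surjˡ X (k ∘ (id ⊗₁ r⁻¹)))

  Represents : ∀ {W} → Hom I W → Hom (W *) I → Set (o ⊔ h ⊔ e)
  Represents {W} w φ = ∀ {Y} (χ : Hom Y (W *)) → ev ∘ (σ ∘ (χ ⊗₁ w)) ≈ φ ∘ (χ ∘ ρ⇒)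

  represent : IsStarAutonomous → (W : Obj) (φ : Hom (W *) I) → Σ[ w ∈ Hom I W ] Represents w φ
  represent star W φ = w , represents
    where
    φ̂ : Hom I ((W *) *)
    φ̂ = curry (φ ∘ ρ⇒)
    w : Hom I W
    w = proj₁ (star W) ∘ φ̂
    represents : Represents w φ
    represents χ = begin
      ev ∘ (σ ∘ (χ ⊗₁ w))                ≈⟨ pullˡ (≈-sym ev-curry) ⟩
      (ev ∘ (id ⊗₁ j W)) ∘ (χ ⊗₁ w)       ≈⟨ assoc ⟩
      ev ∘ ((id ⊗₁ j W) ∘ (χ ⊗₁ w))       ≈⟨ refl⟩∘⟨ merge ⟩
      ev ∘ ((id ∘ χ) ⊗₁ (j W ∘ w))        ≈⟨ refl⟩∘⟨ (identityˡ ⟩⊗⟨ cancelˡ (proj₂ (proj₂ (star W)))) ⟩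
      ev ∘ (χ ⊗₁ φ̂)                       ≈⟨ refl⟩∘⟨ ⊗-as-ʳˡ ⟩
      ev ∘ ((id ⊗₁ φ̂) ∘ (χ ⊗₁ id))        ≈⟨ pullˡ ev-curry ⟩
      (φ ∘ ρ⇒) ∘ (χ ⊗₁ id)                ≈⟨ ≈-trans assoc (refl⟩∘⟨ ρ-natural) ⟩
      φ ∘ (χ ∘ ρ⇒) ∎

  module Duality (A : Obj) where
    evA : Hom (A ⊗₀ [ A , A ]) A
    evA = ev
    evD : Hom (A ⊗₀ A *) I
    evD = ev

    snakeˡ : Hom I (A * ⊗₀ A) → Hom A A
    snakeˡ η = unitorˡ⇒ ∘ ((evD ⊗₁ id {A}) ∘ (α⇐ ∘ ((id {A} ⊗₁ η) ∘ ρ⇐)))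

    snakeʳ : Hom I (A * ⊗₀ A) → Hom (A *) (A *)
    snakeʳ η = ρ⇒ ∘ ((id {A *} ⊗₁ evD) ∘ (α⇒ ∘ ((η ⊗₁ id {A *}) ∘ unitorˡ⇐)))

    snakeʳ-snakeˡ : (η : Hom I (A * ⊗₀ A)) → evD ∘ (id ⊗₁ snakeʳ η) ≈ evD ∘ (snakeˡ η ⊗₁ id)
    snakeʳ-snakeˡ η = begin
      evD ∘ (id ⊗₁ snakeʳ η)                  ≈⟨ expandʳ ⟩
      ρ⇒ ∘ ((evD ⊗₁ evD) ∘ shuffle)            ≈⟨ ≈-sym unitorˡ≈ρ⇒ ⟩∘⟨refl ⟩
      unitorˡ⇒ ∘ ((evD ⊗₁ evD) ∘ shuffle)      ≈⟨ expandˡ ⟨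
      evD ∘ (snakeˡ η ⊗₁ id) ∎
      where
      shuffle : Hom (A ⊗₀ A *) ((A ⊗₀ A *) ⊗₀ (A ⊗₀ A *))
      shuffle = α⇒ ∘ ((α⇐ ⊗₁ id) ∘ (((id ⊗₁ η) ⊗₁ id) ∘ (ρ⇐ ⊗₁ id)))
      Y = (id ⊗₁ evD) ∘ (α⇒ ∘ ((η ⊗₁ id {A *}) ∘ unitorˡ⇐))
      expandʳ : evD ∘ (id ⊗₁ snakeʳ η) ≈ ρ⇒ ∘ ((evD ⊗₁ evD) ∘ shuffle)
      expandʳ = begin
        evD ∘ (id ⊗₁ snakeʳ η)                                  ≈⟨ refl⟩∘⟨ split₂ ⟩
        evD ∘ ((id ⊗₁ ρ⇒) ∘ (id ⊗₁ Y))                          ≈⟨ pullˡ ρ⇒-⊗-natural ⟩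
        (ρ⇒ ∘ ((evD ⊗₁ id) ∘ α⇐)) ∘ (id ⊗₁ Y)                   ≈⟨ ≈-trans assoc (refl⟩∘⟨ assoc) ⟩
        ρ⇒ ∘ ((evD ⊗₁ id) ∘ (α⇐ ∘ (id ⊗₁ Y)))                   ≈⟨ refl⟩∘⟨ refl⟩∘⟨ refl⟩∘⟨ ≈-trans split₂ (refl⟩∘⟨ ≈-trans split₂ (refl⟩∘⟨ split₂)) ⟩
        ρ⇒ ∘ ((evD ⊗₁ id) ∘ (α⇐ ∘ ((id ⊗₁ (id ⊗₁ evD)) ∘ ((id ⊗₁ α⇒) ∘ ((id ⊗₁ (η ⊗₁ id)) ∘ (id ⊗₁ unitorˡ⇐)))))) ≈⟨ refl⟩∘⟨ refl⟩∘⟨ pullˡ α⇐-natural ⟩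
        ρ⇒ ∘ ((evD ⊗₁ id) ∘ ((((id ⊗₁ id) ⊗₁ evD) ∘ α⇐) ∘ ((id ⊗₁ α⇒) ∘ ((id ⊗₁ (η ⊗₁ id)) ∘ (id ⊗₁ unitorˡ⇐))))) ≈⟨ refl⟩∘⟨ ≈-trans (refl⟩∘⟨ assoc) (pullˡ (≈-trans (refl⟩∘⟨ ididˡ) (≈-sym ⊗-as-ˡʳ))) ⟩
        ρ⇒ ∘ ((evD ⊗₁ evD) ∘ (α⇐ ∘ ((id ⊗₁ α⇒) ∘ ((id ⊗₁ (η ⊗₁ id)) ∘ (id ⊗₁ unitorˡ⇐))))) ≈⟨ refl⟩∘⟨ refl⟩∘⟨ ≈-trans (pullˡ pentagon-α⇐) assoc ⟩
        ρ⇒ ∘ ((evD ⊗₁ evD) ∘ (α⇒ ∘ (((α⇐ ⊗₁ id) ∘ α⇐) ∘ ((id ⊗₁ (η ⊗₁ id)) ∘ (id ⊗₁ unitorˡ⇐))))) ≈⟨ refl⟩∘⟨ refl⟩∘⟨ refl⟩∘⟨ assoc ⟩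
        ρ⇒ ∘ ((evD ⊗₁ evD) ∘ (α⇒ ∘ ((α⇐ ⊗₁ id) ∘ (α⇐ ∘ ((id ⊗₁ (η ⊗₁ id)) ∘ (id ⊗₁ unitorˡ⇐)))))) ≈⟨ refl⟩∘⟨ refl⟩∘⟨ refl⟩∘⟨ refl⟩∘⟨ ≈-trans (pullˡ α⇐-natural) (≈-trans assoc (refl⟩∘⟨ triangle⇐)) ⟩
        ρ⇒ ∘ ((evD ⊗₁ evD) ∘ shuffle) ∎
      expandˡ : evD ∘ (snakeˡ η ⊗₁ id) ≈ unitorˡ⇒ ∘ ((evD ⊗₁ evD) ∘ shuffle)
      expandˡ = begin
        evD ∘ (snakeˡ η ⊗₁ id)   ≈⟨ refl⟩∘⟨ ≈-trans split₁ (refl⟩∘⟨ ≈-trans split₁ (refl⟩∘⟨ ≈-trans split₁ (refl⟩∘⟨ split₁))) ⟩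
        evD ∘ ((unitorˡ⇒ ⊗₁ id) ∘ (((evD ⊗₁ id) ⊗₁ id) ∘ ((α⇐ ⊗₁ id) ∘ (((id ⊗₁ η) ⊗₁ id) ∘ (ρ⇐ ⊗₁ id))))) ≈⟨ pullˡ unitorˡ-⊗-natural ⟩
        (unitorˡ⇒ ∘ ((id ⊗₁ evD) ∘ α⇒)) ∘ (((evD ⊗₁ id) ⊗₁ id) ∘ ((α⇐ ⊗₁ id) ∘ (((id ⊗₁ η) ⊗₁ id) ∘ (ρ⇐ ⊗₁ id)))) ≈⟨ ≈-trans assoc (refl⟩∘⟨ ≈-trans assoc (refl⟩∘⟨ pullˡ α-natural)) ⟩
        unitorˡ⇒ ∘ ((id ⊗₁ evD) ∘ (((evD ⊗₁ (id ⊗₁ id)) ∘ α⇒) ∘ ((α⇐ ⊗₁ id) ∘ (((id ⊗₁ η) ⊗₁ id) ∘ (ρ⇐ ⊗₁ id))))) ≈⟨ refl⟩∘⟨ ≈-trans (refl⟩∘⟨ assoc) (pullˡ (≈-trans (refl⟩∘⟨ ididʳ) (≈-sym ⊗-as-ʳˡ))) ⟩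
        unitorˡ⇒ ∘ ((evD ⊗₁ evD) ∘ shuffle) ∎

    adjunction-from-snakeˡ : (η : Hom I (A * ⊗₀ A)) → snakeˡ η ≈ id → IsAdjunction A (A *) η evD
    adjunction-from-snakeˡ η triangle = triangle , ev-ext (begin
      evD ∘ (id ⊗₁ snakeʳ η)   ≈⟨ snakeʳ-snakeˡ η ⟩
      evD ∘ (snakeˡ η ⊗₁ id)   ≈⟨ refl⟩∘⟨ (triangle ⟩⊗⟨ ≈-refl) ⟩
      evD ∘ (id ⊗₁ id) ∎)

    transpose : Hom A A → Hom (A *) (A *)
    transpose f = curry (evD ∘ (f ⊗₁ id))

    snakeˡ-transpose : (η : Hom I (A * ⊗₀ A)) (f : Hom A A) → snakeˡ ((transpose f ⊗₁ id) ∘ η) ≈ snakeˡ η ∘ f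
    snakeˡ-transpose η f = begin
      unitorˡ⇒ ∘ ((evD ⊗₁ id) ∘ (α⇐ ∘ ((id ⊗₁ ((f* ⊗₁ id) ∘ η)) ∘ ρ⇐)))    ≈⟨ refl⟩∘⟨ refl⟩∘⟨ refl⟩∘⟨ (split₂ ⟩∘⟨refl) ⟩
      unitorˡ⇒ ∘ ((evD ⊗₁ id) ∘ (α⇐ ∘ (((id ⊗₁ (f* ⊗₁ id)) ∘ (id ⊗₁ η)) ∘ ρ⇐))) ≈⟨ refl⟩∘⟨ refl⟩∘⟨ ≈-trans (refl⟩∘⟨ assoc) (pullˡ α⇐-natural) ⟩
      unitorˡ⇒ ∘ ((evD ⊗₁ id) ∘ ((((id ⊗₁ f*) ⊗₁ id) ∘ α⇐) ∘ ((id ⊗₁ η) ∘ ρ⇐))) ≈⟨ refl⟩∘⟨ ≈-trans (refl⟩∘⟨ assoc) (pullˡ transpose-spec) ⟩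
      unitorˡ⇒ ∘ (((evD ⊗₁ id) ∘ ((f ⊗₁ id) ⊗₁ id)) ∘ (α⇐ ∘ ((id ⊗₁ η) ∘ ρ⇐))) ≈⟨ refl⟩∘⟨ ≈-trans assoc (refl⟩∘⟨ pullˡ (≈-sym α⇐-natural)) ⟩
      unitorˡ⇒ ∘ ((evD ⊗₁ id) ∘ ((α⇐ ∘ (f ⊗₁ (id ⊗₁ id))) ∘ ((id ⊗₁ η) ∘ ρ⇐))) ≈⟨ refl⟩∘⟨ refl⟩∘⟨ ≈-trans assoc (refl⟩∘⟨ (ididʳ ⟩∘⟨refl)) ⟩
      unitorˡ⇒ ∘ ((evD ⊗₁ id) ∘ (α⇐ ∘ ((f ⊗₁ id) ∘ ((id ⊗₁ η) ∘ ρ⇐)))) ≈⟨ refl⟩∘⟨ refl⟩∘⟨ refl⟩∘⟨ ≈-trans (pullˡ interchange) assoc ⟩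
      unitorˡ⇒ ∘ ((evD ⊗₁ id) ∘ (α⇐ ∘ ((id ⊗₁ η) ∘ ((f ⊗₁ id) ∘ ρ⇐)))) ≈⟨ refl⟩∘⟨ refl⟩∘⟨ refl⟩∘⟨ refl⟩∘⟨ ≈-sym ρ⇐-natural ⟩
      unitorˡ⇒ ∘ ((evD ⊗₁ id) ∘ (α⇐ ∘ ((id ⊗₁ η) ∘ (ρ⇐ ∘ f)))) ≈⟨ assoc₄ ⟨
      snakeˡ η ∘ f ∎
      where
      f* = transpose f
      transpose-spec : (evD ⊗₁ id {A}) ∘ ((id ⊗₁ f*) ⊗₁ id) ≈ (evD ⊗₁ id) ∘ ((f ⊗₁ id) ⊗₁ id)
      transpose-spec = ≈-trans merge₁ (≈-trans (ev-curry ⟩⊗⟨ ≈-refl) split₁)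

    -- a ⊗ d ↦ (x ↦ d x · a)
    rankOne : Hom (A ⊗₀ A *) [ A , A ]
    rankOne = curry (unitorˡ⇒ ∘ ((evD ⊗₁ id) ∘ (α⇐ ∘ (id ⊗₁ σ {A} {A *}))))

    rankOneAt : Hom I A → Hom (A *) [ A , A ]
    rankOneAt p = curry (p ∘ evD)

    applyAt : Hom I A → Hom A [ A , A ] → Hom A A
    applyAt p g = evA ∘ ((p ⊗₁ g) ∘ unitorˡ⇐)

    rankOne-applyAt : (p : Hom I A) (g : Hom A [ A , A ]) →
                      rankOne ∘ (applyAt p g ⊗₁ id) ≈ intComp A ∘ (σ ∘ (g ⊗₁ rankOneAt p))
    rankOne-applyAt p g = ev-ext (≈-trans lhs (≈-sym rhs))
      where
      s = applyAt p g
      common : Hom (A ⊗₀ (A ⊗₀ A *)) A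
      common = evA ∘ ((p ⊗₁ g) ∘ ((evD ⊗₁ id) ∘ (α⇐ ∘ (id ⊗₁ σ {A} {A *}))))
      lhs : evA ∘ (id ⊗₁ (rankOne ∘ (s ⊗₁ id))) ≈ common
      lhs = begin
        evA ∘ (id ⊗₁ (rankOne ∘ (s ⊗₁ id)))          ≈⟨ refl⟩∘⟨ split₂ ⟩
        evA ∘ ((id ⊗₁ rankOne) ∘ (id ⊗₁ (s ⊗₁ id)))  ≈⟨ pullˡ ev-curry ⟩
        (unitorˡ⇒ ∘ ((evD ⊗₁ id) ∘ (α⇐ ∘ (id ⊗₁ σ)))) ∘ (id ⊗₁ (s ⊗₁ id)) ≈⟨ ≈-trans assoc (refl⟩∘⟨ ≈-trans assoc (refl⟩∘⟨ assoc)) ⟩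
        unitorˡ⇒ ∘ ((evD ⊗₁ id) ∘ (α⇐ ∘ ((id ⊗₁ σ) ∘ (id ⊗₁ (s ⊗₁ id))))) ≈⟨ refl⟩∘⟨ refl⟩∘⟨ refl⟩∘⟨ ≈-trans merge₂ (≈-trans (≈-refl ⟩⊗⟨ σ-natural) split₂) ⟩
        unitorˡ⇒ ∘ ((evD ⊗₁ id) ∘ (α⇐ ∘ ((id ⊗₁ (id ⊗₁ s)) ∘ (id ⊗₁ σ)))) ≈⟨ refl⟩∘⟨ refl⟩∘⟨ pullˡ α⇐-natural ⟩
        unitorˡ⇒ ∘ ((evD ⊗₁ id) ∘ ((((id ⊗₁ id) ⊗₁ s) ∘ α⇐) ∘ (id ⊗₁ σ))) ≈⟨ refl⟩∘⟨ refl⟩∘⟨ ≈-trans assoc (ididˡ ⟩∘⟨refl) ⟩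
        unitorˡ⇒ ∘ ((evD ⊗₁ id) ∘ ((id ⊗₁ s) ∘ (α⇐ ∘ (id ⊗₁ σ))))  ≈⟨ refl⟩∘⟨ ≈-trans (pullˡ interchange) assoc ⟩
        unitorˡ⇒ ∘ ((id ⊗₁ s) ∘ ((evD ⊗₁ id) ∘ (α⇐ ∘ (id ⊗₁ σ))))  ≈⟨ pullˡ unitorˡ-natural ⟩
        (s ∘ unitorˡ⇒) ∘ ((evD ⊗₁ id) ∘ (α⇐ ∘ (id ⊗₁ σ)))          ≈⟨ ≈-trans assoc (refl⟩∘⟨ ≈-trans assoc (cancelʳ unitorˡ-isoˡ)) ⟩∘⟨refl ⟩
        (evA ∘ (p ⊗₁ g)) ∘ ((evD ⊗₁ id) ∘ (α⇐ ∘ (id ⊗₁ σ)))        ≈⟨ assoc ⟩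
        common ∎
      rhs : evA ∘ (id ⊗₁ (intComp A ∘ (σ ∘ (g ⊗₁ rankOneAt p)))) ≈ common
      rhs = begin
        evA ∘ (id ⊗₁ (intComp A ∘ (σ ∘ (g ⊗₁ rk))))                 ≈⟨ refl⟩∘⟨ split₂ ⟩
        evA ∘ ((id ⊗₁ intComp A) ∘ (id ⊗₁ (σ ∘ (g ⊗₁ rk))))         ≈⟨ pullˡ ev-curry ⟩
        (evA ∘ ((evA ⊗₁ id) ∘ α⇐)) ∘ (id ⊗₁ (σ ∘ (g ⊗₁ rk)))        ≈⟨ ≈-trans assoc (refl⟩∘⟨ assoc) ⟩
        evA ∘ ((evA ⊗₁ id) ∘ (α⇐ ∘ (id ⊗₁ (σ ∘ (g ⊗₁ rk)))))        ≈⟨ refl⟩∘⟨ refl⟩∘⟨ refl⟩∘⟨ ≈-trans (≈-refl ⟩⊗⟨ σ-natural) split₂ ⟩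
        evA ∘ ((evA ⊗₁ id) ∘ (α⇐ ∘ ((id ⊗₁ (rk ⊗₁ g)) ∘ (id ⊗₁ σ)))) ≈⟨ refl⟩∘⟨ refl⟩∘⟨ ≈-trans (pullˡ α⇐-natural) assoc ⟩
        evA ∘ ((evA ⊗₁ id) ∘ (((id ⊗₁ rk) ⊗₁ g) ∘ (α⇐ ∘ (id ⊗₁ σ)))) ≈⟨ refl⟩∘⟨ pullˡ evaluate-rk ⟩
        evA ∘ (((p ⊗₁ g) ∘ (evD ⊗₁ id)) ∘ (α⇐ ∘ (id ⊗₁ σ)))          ≈⟨ refl⟩∘⟨ assoc ⟩
        common ∎
        where
        rk = rankOneAt p
        evaluate-rk : (evA ⊗₁ id) ∘ ((id ⊗₁ rk) ⊗₁ g) ≈ (p ⊗₁ g) ∘ (evD ⊗₁ id)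
        evaluate-rk = ≈-trans merge (≈-trans (ev-curry ⟩⊗⟨ ≈-trans identityˡ (≈-sym identityʳ)) split)

    dualEval : Hom (A * ⊗₀ (A ⊗₀ [ A , A ])) I
    dualEval = evD ∘ (σ ∘ (id ⊗₁ evA))

    twoPairings : Hom ((A ⊗₀ (A * ⊗₀ A)) ⊗₀ A *) I
    twoPairings = unitorˡ⇒ ∘ ((evD ⊗₁ evD) ∘ (α⇒ ∘ (α⇐ ⊗₁ id)))

    insertPoint : Hom I (A * ⊗₀ A) → Hom (A ⊗₀ A *) ((A ⊗₀ (A * ⊗₀ A)) ⊗₀ A *)
    insertPoint w = ((id ⊗₁ w) ∘ ρ⇐) ⊗₁ id

    moveLeft : Hom ((A ⊗₀ (A * ⊗₀ A)) ⊗₀ A *) ((A * ⊗₀ A) ⊗₀ (A ⊗₀ A *))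
    moveLeft = α⇒ ∘ (σ {A} {A * ⊗₀ A} ⊗₁ id {A *})

    snakeˡ-twoPairings : (w : Hom I (A * ⊗₀ A)) → evD ∘ (snakeˡ w ⊗₁ id) ≈ twoPairings ∘ insertPoint w
    snakeˡ-twoPairings w = begin
      evD ∘ (snakeˡ w ⊗₁ id)   ≈⟨ refl⟩∘⟨ ≈-trans split₁ (refl⟩∘⟨ ≈-trans split₁ (refl⟩∘⟨ split₁)) ⟩
      evD ∘ ((unitorˡ⇒ ⊗₁ id) ∘ (((evD ⊗₁ id) ⊗₁ id) ∘ ((α⇐ ⊗₁ id) ∘ insertPoint w))) ≈⟨ pullˡ unitorˡ-⊗-natural ⟩
      (unitorˡ⇒ ∘ ((id ⊗₁ evD) ∘ α⇒)) ∘ (((evD ⊗₁ id) ⊗₁ id) ∘ ((α⇐ ⊗₁ id) ∘ insertPoint w)) ≈⟨ ≈-trans assoc (refl⟩∘⟨ ≈-trans assoc (refl⟩∘⟨ pullˡ α-natural)) ⟩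
      unitorˡ⇒ ∘ ((id ⊗₁ evD) ∘ ((evD ⊗₁ (id ⊗₁ id)) ∘ α⇒) ∘ ((α⇐ ⊗₁ id) ∘ insertPoint w)) ≈⟨ refl⟩∘⟨ refl⟩∘⟨ assoc ⟩
      unitorˡ⇒ ∘ ((id ⊗₁ evD) ∘ ((evD ⊗₁ (id ⊗₁ id)) ∘ (α⇒ ∘ ((α⇐ ⊗₁ id) ∘ insertPoint w)))) ≈⟨ refl⟩∘⟨ pullˡ (≈-trans (refl⟩∘⟨ ididʳ) (≈-sym ⊗-as-ʳˡ)) ⟩
      unitorˡ⇒ ∘ ((evD ⊗₁ evD) ∘ (α⇒ ∘ ((α⇐ ⊗₁ id) ∘ insertPoint w)))  ≈⟨ refl⟩∘⟨ refl⟩∘⟨ sym-assoc ⟩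
      unitorˡ⇒ ∘ ((evD ⊗₁ evD) ∘ ((α⇒ ∘ (α⇐ ⊗₁ id)) ∘ insertPoint w))  ≈⟨ ≈-trans (refl⟩∘⟨ sym-assoc) sym-assoc ⟩
      twoPairings ∘ insertPoint w ∎

    point⊗-unitorˡ⇐ : (w : Hom I (A * ⊗₀ A)) → (w ⊗₁ id) ∘ unitorˡ⇐ {A ⊗₀ A *} ≈ moveLeft ∘ insertPoint w
    point⊗-unitorˡ⇐ w = begin
      (w ⊗₁ id) ∘ unitorˡ⇐                          ≈⟨ refl⟩∘⟨ unitorˡ⇐-α⇒ ⟩
      (w ⊗₁ id) ∘ (α⇒ ∘ (unitorˡ⇐ ⊗₁ id))           ≈⟨ (≈-refl ⟩⊗⟨ ≈-sym ⊗-id) ⟩∘⟨refl ⟩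
      (w ⊗₁ (id ⊗₁ id)) ∘ (α⇒ ∘ (unitorˡ⇐ ⊗₁ id))   ≈⟨ pullˡ (≈-sym α-natural) ⟩
      (α⇒ ∘ ((w ⊗₁ id) ⊗₁ id)) ∘ (unitorˡ⇐ ⊗₁ id)   ≈⟨ ≈-trans assoc (refl⟩∘⟨ merge₁) ⟩
      α⇒ ∘ (((w ⊗₁ id) ∘ unitorˡ⇐) ⊗₁ id)           ≈⟨ refl⟩∘⟨ ((refl⟩∘⟨ ≈-sym σ-ρ⇐) ⟩⊗⟨ ≈-refl) ⟩
      α⇒ ∘ (((w ⊗₁ id) ∘ (σ ∘ ρ⇐)) ⊗₁ id)           ≈⟨ refl⟩∘⟨ (pullˡ (≈-sym σ-natural) ⟩⊗⟨ ≈-refl) ⟩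
      α⇒ ∘ (((σ ∘ (id ⊗₁ w)) ∘ ρ⇐) ⊗₁ id)           ≈⟨ refl⟩∘⟨ (assoc ⟩⊗⟨ ≈-refl) ⟩
      α⇒ ∘ ((σ ∘ ((id ⊗₁ w) ∘ ρ⇐)) ⊗₁ id)           ≈⟨ ≈-trans (refl⟩∘⟨ split₁) sym-assoc ⟩
      moveLeft ∘ insertPoint w ∎
    dualEval-rankOne : dualEval ∘ (α⇒ ∘ ((id ⊗₁ rankOne) ∘ moveLeft)) ≈ twoPairings
    dualEval-rankOne = begin
      (evD ∘ (σ ∘ (id ⊗₁ evA))) ∘ (α⇒ ∘ ((id ⊗₁ rankOne) ∘ rest))   ≈⟨ ≈-trans assoc (refl⟩∘⟨ assoc) ⟩
      evD ∘ (σ ∘ ((id ⊗₁ evA) ∘ (α⇒ ∘ ((id ⊗₁ rankOne) ∘ rest))))   ≈⟨ refl⟩∘⟨ refl⟩∘⟨ refl⟩∘⟨ pullˡ (≈-trans (refl⟩∘⟨ (≈-sym ⊗-id ⟩⊗⟨ ≈-refl)) α-natural) ⟩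
      evD ∘ (σ ∘ ((id ⊗₁ evA) ∘ (((id ⊗₁ (id ⊗₁ rankOne)) ∘ α⇒) ∘ rest))) ≈⟨ refl⟩∘⟨ refl⟩∘⟨ ≈-trans (refl⟩∘⟨ assoc) (pullˡ (≈-trans merge₂ (≈-refl ⟩⊗⟨ ev-curry))) ⟩
      evD ∘ (σ ∘ ((id ⊗₁ (unitorˡ⇒ ∘ Q)) ∘ (α⇒ ∘ rest)))                   ≈⟨ refl⟩∘⟨ refl⟩∘⟨ (split₂ ⟩∘⟨refl) ⟩
      evD ∘ (σ ∘ (((id ⊗₁ unitorˡ⇒) ∘ (id ⊗₁ Q)) ∘ (α⇒ ∘ rest))) ≈⟨ refl⟩∘⟨ ≈-trans (refl⟩∘⟨ assoc) (pullˡ σ-natural) ⟩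
      evD ∘ (((unitorˡ⇒ ⊗₁ id) ∘ σ) ∘ ((id ⊗₁ Q) ∘ (α⇒ ∘ rest))) ≈⟨ refl⟩∘⟨ assoc ⟩
      evD ∘ ((unitorˡ⇒ ⊗₁ id) ∘ (σ ∘ ((id ⊗₁ Q) ∘ (α⇒ ∘ rest)))) ≈⟨ pullˡ unitorˡ-⊗-natural ⟩
      (unitorˡ⇒ ∘ ((id ⊗₁ evD) ∘ α⇒)) ∘ (σ ∘ ((id ⊗₁ Q) ∘ (α⇒ ∘ rest))) ≈⟨ ≈-trans assoc (refl⟩∘⟨ assoc) ⟩
      unitorˡ⇒ ∘ ((id ⊗₁ evD) ∘ (α⇒ ∘ (σ ∘ ((id ⊗₁ Q) ∘ (α⇒ ∘ rest))))) ≈⟨ refl⟩∘⟨ refl⟩∘⟨ refl⟩∘⟨ refl⟩∘⟨ (split₂ ⟩∘⟨refl) ⟩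
      unitorˡ⇒ ∘ ((id ⊗₁ evD) ∘ (α⇒ ∘ (σ ∘ (((id ⊗₁ (evD ⊗₁ id)) ∘ T) ∘ (α⇒ ∘ rest))))) ≈⟨ refl⟩∘⟨ refl⟩∘⟨ refl⟩∘⟨ ≈-trans (refl⟩∘⟨ assoc) (pullˡ σ-natural) ⟩
      unitorˡ⇒ ∘ ((id ⊗₁ evD) ∘ (α⇒ ∘ ((((evD ⊗₁ id) ⊗₁ id) ∘ σ) ∘ (T ∘ (α⇒ ∘ rest))))) ≈⟨ refl⟩∘⟨ refl⟩∘⟨ ≈-trans (refl⟩∘⟨ assoc) (pullˡ α-natural) ⟩
      unitorˡ⇒ ∘ ((id ⊗₁ evD) ∘ (((evD ⊗₁ (id ⊗₁ id)) ∘ α⇒) ∘ (σ ∘ (T ∘ (α⇒ ∘ rest))))) ≈⟨ refl⟩∘⟨ ≈-trans (refl⟩∘⟨ assoc) (pullˡ (≈-trans (refl⟩∘⟨ ididʳ) (≈-sym ⊗-as-ʳˡ))) ⟩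
      unitorˡ⇒ ∘ ((evD ⊗₁ evD) ∘ (α⇒ ∘ (σ ∘ (T ∘ (α⇒ ∘ rest))))) ≈⟨ refl⟩∘⟨ refl⟩∘⟨ permutation-coherence ⟩
      unitorˡ⇒ ∘ ((evD ⊗₁ evD) ∘ (σ ∘ (α⇒ ∘ (α⇐ ⊗₁ id))))     ≈⟨ refl⟩∘⟨ pullˡ (≈-sym σ-natural) ⟩
      unitorˡ⇒ ∘ ((σ ∘ (evD ⊗₁ evD)) ∘ (α⇒ ∘ (α⇐ ⊗₁ id)))     ≈⟨ refl⟩∘⟨ assoc ⟩
      unitorˡ⇒ ∘ (σ ∘ ((evD ⊗₁ evD) ∘ (α⇒ ∘ (α⇐ ⊗₁ id))))     ≈⟨ pullˡ unitorˡ-σ-I ⟩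
      twoPairings ∎
      where
      rest = moveLeft
      Q = (evD ⊗₁ id) ∘ (α⇐ ∘ (id ⊗₁ σ {A} {A *}))
      T = id {A *} ⊗₁ (α⇐ ∘ (id ⊗₁ σ {A} {A *}))


  module Reflexive (A : Obj) (j⁻¹ : Hom ((A *) *) A) (j⁻¹∘j≈id : j⁻¹ ∘ j A ≈ id) where
    open Duality A

    toFunctional : Hom [ A , A ] ((A * ⊗₀ A) *)
    toFunctional = curry (dualEval ∘ α⇒)

    fromFunctional : Hom ((A * ⊗₀ A) *) [ A , A ]
    fromFunctional = curry (j⁻¹ ∘ curry (ev ∘ α⇐))

    fromFunctional∘toFunctional : fromFunctional ∘ toFunctional ≈ id
    fromFunctional∘toFunctional = ev-ext (begin
      evA ∘ (id ⊗₁ (fromFunctional ∘ toFunctional))                   ≈⟨ refl⟩∘⟨ split₂ ⟩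
      evA ∘ ((id ⊗₁ fromFunctional) ∘ (id ⊗₁ toFunctional))           ≈⟨ pullˡ ev-curry ⟩
      (j⁻¹ ∘ curry (ev ∘ α⇐)) ∘ (id ⊗₁ toFunctional)                   ≈⟨ assoc ⟩
      j⁻¹ ∘ (curry (ev ∘ α⇐) ∘ (id ⊗₁ toFunctional))                   ≈⟨ refl⟩∘⟨ ≈-trans curry-∘ (curry-cong evaluate) ⟩
      j⁻¹ ∘ curry dualEval                                             ≈⟨ refl⟩∘⟨ ≈-trans curry-∘ (curry-cong assoc) ⟨
      j⁻¹ ∘ (j A ∘ evA)                                                ≈⟨ cancelˡ j⁻¹∘j≈id ⟩
      evA                                                              ≈⟨ ev-id ⟨
      evA ∘ (id ⊗₁ id) ∎)
      where
      evaluate : (ev ∘ α⇐) ∘ (id ⊗₁ (id ⊗₁ toFunctional)) ≈ dualEval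
      evaluate = begin
        (ev ∘ α⇐) ∘ (id ⊗₁ (id ⊗₁ toFunctional))   ≈⟨ assoc ⟩
        ev ∘ (α⇐ ∘ (id ⊗₁ (id ⊗₁ toFunctional)))   ≈⟨ refl⟩∘⟨ α⇐-natural ⟩
        ev ∘ (((id ⊗₁ id) ⊗₁ toFunctional) ∘ α⇐)   ≈⟨ refl⟩∘⟨ (ididˡ ⟩∘⟨refl) ⟩
        ev ∘ ((id ⊗₁ toFunctional) ∘ α⇐)           ≈⟨ pullˡ ev-curry ⟩
        (dualEval ∘ α⇒) ∘ α⇐                       ≈⟨ ≈-trans assoc (cancelʳ α-isoʳ) ⟩
        dualEval ∎

    ev-injectiveˡ : ∀ {f g : Hom A A} → evD ∘ (f ⊗₁ id) ≈ evD ∘ (g ⊗₁ id) → f ≈ g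
    ev-injectiveˡ {f} {g} f≈g = cancel-isoˡ j⁻¹∘j≈id (begin
      j A ∘ f                          ≈⟨ j-∘ ⟩
      curry (evD ∘ ((f ⊗₁ id) ∘ σ))    ≈⟨ curry-cong (≈-trans sym-assoc (≈-trans (f≈g ⟩∘⟨refl) assoc)) ⟩
      curry (evD ∘ ((g ⊗₁ id) ∘ σ))    ≈⟨ j-∘ ⟨
      j A ∘ g ∎)
      where
      j-∘ : ∀ {f : Hom A A} → j A ∘ f ≈ curry (evD ∘ ((f ⊗₁ id) ∘ σ))
      j-∘ = ≈-trans curry-∘ (curry-cong (≈-trans assoc (refl⟩∘⟨ σ-natural)))

    snakeˡ-rankOne : (τ : Hom [ A , A ] I) (w : Hom I (A * ⊗₀ A)) → Represents w (τ ∘ fromFunctional) →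
                     evD ∘ (snakeˡ w ⊗₁ id) ≈ τ ∘ rankOne
    snakeˡ-rankOne τ w represents = begin
      evD ∘ (snakeˡ w ⊗₁ id)                                           ≈⟨ snakeˡ-twoPairings w ⟩
      twoPairings ∘ insertPoint w                                      ≈⟨ ≈-sym dualEval-rankOne ⟩∘⟨refl ⟩
      (dualEval ∘ (α⇒ ∘ ((id ⊗₁ rankOne) ∘ moveLeft))) ∘ insertPoint w  ≈⟨ viaFunctional ⟨
      τ ∘ rankOne ∎
      where
      viaFunctional : τ ∘ rankOne ≈ (dualEval ∘ (α⇒ ∘ ((id ⊗₁ rankOne) ∘ moveLeft))) ∘ insertPoint w
      viaFunctional = begin
        τ ∘ rankOne                                            ≈⟨ refl⟩∘⟨ ≈-sym (cancelʳ ρ-isoʳ) ⟩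
        τ ∘ (rankOne ∘ (ρ⇒ ∘ ρ⇐))                              ≈⟨ refl⟩∘⟨ sym-assoc ⟩
        τ ∘ ((rankOne ∘ ρ⇒) ∘ ρ⇐)                              ≈⟨ refl⟩∘⟨ (≈-sym retract ⟩∘⟨refl) ⟩
        τ ∘ ((fromFunctional ∘ (χ ∘ ρ⇒)) ∘ ρ⇐)                 ≈⟨ ≈-trans sym-assoc (sym-assoc ⟩∘⟨refl) ⟩
        ((τ ∘ fromFunctional) ∘ (χ ∘ ρ⇒)) ∘ ρ⇐                 ≈⟨ ≈-sym (represents χ) ⟩∘⟨refl ⟩
        (ev ∘ (σ ∘ (χ ⊗₁ w))) ∘ ρ⇐                             ≈⟨ ≈-trans assoc (refl⟩∘⟨ assoc) ⟩
        ev ∘ (σ ∘ ((χ ⊗₁ w) ∘ ρ⇐))                             ≈⟨ refl⟩∘⟨ ≈-trans (pullˡ σ-natural) assoc ⟩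
        ev ∘ ((w ⊗₁ χ) ∘ (σ ∘ ρ⇐))                             ≈⟨ refl⟩∘⟨ (≈-trans (≈-sym identityˡ ⟩⊗⟨ ≈-refl) split ⟩∘⟨ σ-ρ⇐) ⟩
        ev ∘ (((id ⊗₁ toFunctional) ∘ (w ⊗₁ rankOne)) ∘ unitorˡ⇐) ≈⟨ refl⟩∘⟨ assoc ⟩
        ev ∘ ((id ⊗₁ toFunctional) ∘ ((w ⊗₁ rankOne) ∘ unitorˡ⇐)) ≈⟨ pullˡ ev-curry ⟩
        (dualEval ∘ α⇒) ∘ ((w ⊗₁ rankOne) ∘ unitorˡ⇐)          ≈⟨ assoc ⟩
        dualEval ∘ (α⇒ ∘ ((w ⊗₁ rankOne) ∘ unitorˡ⇐))          ≈⟨ refl⟩∘⟨ refl⟩∘⟨ (⊗-as-ʳˡ ⟩∘⟨refl) ⟩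
        dualEval ∘ (α⇒ ∘ (((id ⊗₁ rankOne) ∘ (w ⊗₁ id)) ∘ unitorˡ⇐)) ≈⟨ refl⟩∘⟨ refl⟩∘⟨ ≈-trans assoc (refl⟩∘⟨ point⊗-unitorˡ⇐ w) ⟩
        dualEval ∘ (α⇒ ∘ ((id ⊗₁ rankOne) ∘ (moveLeft ∘ insertPoint w)))  ≈⟨ refl⟩∘⟨ ≈-trans (refl⟩∘⟨ sym-assoc) sym-assoc ⟩
        dualEval ∘ ((α⇒ ∘ ((id ⊗₁ rankOne) ∘ moveLeft)) ∘ insertPoint w)  ≈⟨ sym-assoc ⟩
        (dualEval ∘ (α⇒ ∘ ((id ⊗₁ rankOne) ∘ moveLeft))) ∘ insertPoint w ∎
        where
        χ = toFunctional ∘ rankOne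
        retract : fromFunctional ∘ (χ ∘ ρ⇒) ≈ rankOne ∘ ρ⇒
        retract = ≈-trans (refl⟩∘⟨ assoc) (≈-trans (pullˡ fromFunctional∘toFunctional) identityˡ)

    -- Pointwise: ⟨ snakeˡ w (g a p) , d ⟩ = τ (g a ∘ rankOneAt p d) = c (p · d a) = d a.
    snakeˡ-applyAt : (τ : Hom [ A , A ] I) (w : Hom I (A * ⊗₀ A)) → Represents w (τ ∘ fromFunctional) →
                     (p : Hom I A) (c : Hom A I) → c ∘ p ≈ id →
                     (g : Hom A [ A , A ]) → τ ∘ (intComp A ∘ (σ ∘ (g ⊗₁ id))) ≈ c ∘ evA →
                     snakeˡ w ∘ applyAt p g ≈ id
    snakeˡ-applyAt τ w represents p c c∘p≈id g τ-g = ev-injectiveˡ (begin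
      evD ∘ ((snakeˡ w ∘ s) ⊗₁ id)                           ≈⟨ refl⟩∘⟨ split₁ ⟩
      evD ∘ ((snakeˡ w ⊗₁ id) ∘ (s ⊗₁ id))                   ≈⟨ pullˡ (snakeˡ-rankOne τ w represents) ⟩
      (τ ∘ rankOne) ∘ (s ⊗₁ id)                              ≈⟨ assoc ⟩
      τ ∘ (rankOne ∘ (s ⊗₁ id))                              ≈⟨ refl⟩∘⟨ rankOne-applyAt p g ⟩
      τ ∘ (μ ∘ (σ ∘ (g ⊗₁ rk)))                              ≈⟨ refl⟩∘⟨ refl⟩∘⟨ refl⟩∘⟨ ⊗-as-ˡʳ ⟩
      τ ∘ (μ ∘ (σ ∘ ((g ⊗₁ id) ∘ (id ⊗₁ rk))))               ≈⟨ ≈-trans (refl⟩∘⟨ ≈-trans (refl⟩∘⟨ sym-assoc) sym-assoc) sym-assoc ⟩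
      (τ ∘ (μ ∘ (σ ∘ (g ⊗₁ id)))) ∘ (id ⊗₁ rk)               ≈⟨ τ-g ⟩∘⟨refl ⟩
      (c ∘ evA) ∘ (id ⊗₁ rk)                                 ≈⟨ ≈-trans assoc (refl⟩∘⟨ ev-curry) ⟩
      c ∘ (p ∘ evD)                                          ≈⟨ ≈-trans (pullˡ c∘p≈id) identityˡ ⟩
      evD                                                    ≈⟨ ev-id ⟨
      evD ∘ (id ⊗₁ id) ∎)
      where
      s = applyAt p g
      μ = intComp A
      rk = rankOneAt p

mainTheorem3 : {o h e : Level} (V : SymMonClosed o h e) →
    let open SymMonClosed V in let open Notions V in
      IsStarAutonomous → (A : Obj) → IsPseudoAffine A →
      (Σ[ B ∈ Obj ] Σ[ ε ∈ Hom ([ A , A ] ⊗₀ B) I ] Σ[ l ∈ Hom [ A , A ] B ]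
         Σ[ r ∈ Hom [ A , A ] B ] IsFrobeniusStructure [ A , A ] B ε (intComp A) l r) →
      PartOfAdjunction A
mainTheorem3 V star A (p , c , c∘p≈id) (B , ε , l , r , frobenius) =
  A * , η , ev , adjunction-from-snakeˡ η (begin
    snakeˡ ((transpose s ⊗₁ id) ∘ w)   ≈⟨ snakeˡ-transpose w s ⟩
    snakeˡ w ∘ s                       ≈⟨ snakeˡ-applyAt trace w represents p c c∘p≈id g trace-g ⟩
    id ∎)
  where
  open SymMonClosed V
  open Notions V
  open Properties V
  open Frobenius⇒Adjunction V
  open FrobeniusTrace frobenius internalId intComp-identityʳ
  open Duality A
  open Reflexive A (proj₁ (star A)) (proj₁ (proj₂ (star A)))

  g : Hom A [ A , A ]
  g = proj₁ (trace-nondegenerate (c ∘ evA))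
  trace-g : trace ∘ (intComp A ∘ (σ ∘ (g ⊗₁ id))) ≈ c ∘ evA
  trace-g = proj₂ (trace-nondegenerate (c ∘ evA))
  w : Hom I (A * ⊗₀ A)
  w = proj₁ (represent star (A * ⊗₀ A) (trace ∘ fromFunctional))
  represents : Represents w (trace ∘ fromFunctional)
  represents = proj₂ (represent star (A * ⊗₀ A) (trace ∘ fromFunctional))
  s : Hom A A
  s = applyAt p g
  η : Hom I (A * ⊗₀ A)
  η = (transpose s ⊗₁ id) ∘ w
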